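{- For $m \in \mathbb{Z}^+$ let \[ \mathcal{S}_m = \{(a,b,c,d) \in \mathcal{P}_m^4 : \gcd(b,c) = 1,\ abcd \in \mathcal{M}_m\}. \] Then \[ |\mathcal{S}_m| = q^m\cdot\left(\frac{q-1}{q}\binom{m+1}{3} + (m+1)^2\right). \]
   Context: $\mathbb{F}$ is a finite field with $q$ elements. $\mathcal{P}_m$ (resp. $\mathcal{M}_m$) is the set of monic polynomials in $\mathbb{F}[x]$ of degree at most $m$ (resp. exactly $m$). -}

module Defs where

open import Level using (Level; _⊔_)
open import Algebra.Bundles using (CommutativeRing)
open import Data.Nat using (ℕ; zero; suc; _≤_)
open import Data.List using (List; []; _∷_; length; map; _++_; [_])
open import Data.List.Relation.Unary.All using (All)
open import Data.List.Relation.Unary.Any using (Any)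
open import Data.List.Relation.Unary.AllPairs using (AllPairs)
open import Data.Vec using (Vec; toList)
open import Data.Product using (Σ; ∃; _×_; _,_)
open import Data.Unit.Polymorphic using (⊤)
open import Relation.Binary.PropositionalEquality using (_≡_)
open import Relation.Nullary using (¬_)

-- Finite cardinality of a predicate P on a type A, up to an equivalence _~_:
-- there is a duplicate-free (w.r.t. ~) list of length N of elements satisfying P
-- such that every element satisfying P is ~-equivalent to some entry.
HasCard : ∀ {a ℓ p} {A : Set a} (_~_ : A → A → Set ℓ) (P : A → Set p) (N : ℕ) → Set (a ⊔ ℓ ⊔ p)
HasCard {A = A} _~_ P N =
  Σ (List A) λ xs →
    (length xs ≡ N) × All P xs × AllPairs (λ x y → ¬ (x ~ y)) xs ×
    (∀ x → P x → Any (x ~_) xs)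

module _ {c ℓ : Level} (R : CommutativeRing c ℓ) where
  open CommutativeRing R

  IsField : Set (c ⊔ ℓ)
  IsField = (¬ (0# ≈ 1#)) × (∀ x → ¬ (x ≈ 0#) → ∃ λ y → (x * y) ≈ 1#)

  HasSize : ℕ → Set (c ⊔ ℓ)
  HasSize q = HasCard _≈_ (λ _ → ⊤ {ℓ = ℓ}) q

  -- Polynomials in R[x] as coefficient lists, lowest degree first.
  Poly : Set c
  Poly = List Carrier

  -- Equality of polynomials (trailing zero coefficients are ignored).
  data _≋_ : Poly → Poly → Set (c ⊔ ℓ) where
    []≋[] : [] ≋ []
    []≋∷  : ∀ {y ys} → y ≈ 0# → [] ≋ ys → [] ≋ (y ∷ ys)
    ∷≋[]  : ∀ {x xs} → x ≈ 0# → xs ≋ [] → (x ∷ xs) ≋ []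
    ∷≋∷   : ∀ {x y xs ys} → x ≈ y → xs ≋ ys → (x ∷ xs) ≋ (y ∷ ys)

  infixl 6 _+ₚ_
  _+ₚ_ : Poly → Poly → Poly
  [] +ₚ q = q
  (a ∷ p) +ₚ [] = a ∷ p
  (a ∷ p) +ₚ (b ∷ q) = (a + b) ∷ (p +ₚ q)

  infixl 7 _*ₚ_
  _*ₚ_ : Poly → Poly → Poly
  [] *ₚ q = []
  (a ∷ p) *ₚ q = map (a *_) q +ₚ (0# ∷ (p *ₚ q))

  -- Monic polynomial of degree exactly k, given by its k lower coefficients.
  monic : ∀ {k} → Vec Carrier k → Poly
  monic v = toList v ++ [ 1# ]

  IsMonicDeg : ℕ → Poly → Set (c ⊔ ℓ)
  IsMonicDeg m p = Σ (Vec Carrier m) λ v → p ≋ monic v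

  _∣ₚ_ : Poly → Poly → Set (c ⊔ ℓ)
  d ∣ₚ p = Σ Poly λ e → (d *ₚ e) ≋ p

  -- gcd(b,c) = 1: every monic common divisor of b and c has degree 0.
  Coprime : Poly → Poly → Set (c ⊔ ℓ)
  Coprime b c' = ∀ k (v : Vec Carrier k) → monic v ∣ₚ b → monic v ∣ₚ c' → k ≡ 0

  -- Elements of 𝓟_m: monic polynomials of degree at most m.
  P : ℕ → Set c
  P m = Σ ℕ λ k → (k ≤ m) × Vec Carrier k

  toPoly : ∀ {m} → P m → Poly
  toPoly (k , _ , v) = monic v

  _≈P_ : ∀ {m} → P m → P m → Set (c ⊔ ℓ)
  a ≈P b = toPoly a ≋ toPoly b

  Quad : ℕ → Set c
  Quad m = P m × P m × P m × P m

  _≈Q_ : ∀ {m} → Quad m → Quad m → Set (c ⊔ ℓ)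
  (a , b , c' , d) ≈Q (a' , b' , c'' , d') = (a ≈P a') × (b ≈P b') × (c' ≈P c'') × (d ≈P d')

  InS : (m : ℕ) → Quad m → Set (c ⊔ ℓ)
  InS m (a , b , c' , d) =
    Coprime (toPoly b) (toPoly c') ×
    IsMonicDeg m (toPoly a *ₚ toPoly b *ₚ toPoly c' *ₚ toPoly d)

module Submission where

-- Grouping a quadruple as ((a,d),(b,c)) and writing s = deg b + deg c, the set 𝓢_m is the
-- disjoint union over s ≤ m of (pairs of monics with degree sum m - s) × (coprime pairs of
-- monics with degree sum s), so |𝓢_m| = ∑_s (m-s+1)q^(m-s) · ∑_j N(j, s-j), where N(j,k) is
-- the number of coprime pairs of monics of degrees j and k.  The heart of the proof is
-- N(j,k) = q^(j+k) if j = 0 or k = 0, and (q-1)q^(j+k-1) otherwise, by strong induction on k: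
--   * for k ≤ j, long division b = Q·c + r is a bijection (b, c) ↦ (Q, c, r) and preserves
--     coprimality (Euclid), so N(j,k) = q^(j-k)·H(k,k), where H(k,n) counts coprime (c, r)
--     with r an arbitrary polynomial with n coefficients;
--   * H(k,n+1) = H(k,n) + (q-1)·N(k,n), splitting on the top coefficient t of r: t = 0
--     drops it, and t ≠ 0 makes r a unit multiple of a monic of degree n;
--   * for k > j use the symmetry N(j,k) = N(k,j).

module Sums where

  open import Data.Nat using (ℕ; zero; suc; _+_; _*_; _<_)
  open import Data.Nat.Properties using (+-comm; +-assoc; *-zeroʳ; *-distribˡ-+; n≤1+n; ≤-refl; ≤-trans)
  open import Data.Nat.Solver using (module +-*-Solver)
  open import Relation.Binary.PropositionalEquality using (_≡_; refl; sym; trans; cong; cong₂)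
  open +-*-Solver using (solve; _:+_; _:=_)

  ∑< : (ℕ → ℕ) → ℕ → ℕ
  ∑< c zero = 0
  ∑< c (suc n) = ∑< c n + c n

  ∑<-cong : ∀ (f g : ℕ → ℕ) n → (∀ t → t < n → f t ≡ g t) → ∑< f n ≡ ∑< g n
  ∑<-cong f g zero eq = refl
  ∑<-cong f g (suc n) eq =
    cong₂ _+_ (∑<-cong f g n (λ t t<n → eq t (≤-trans t<n (n≤1+n n)))) (eq n ≤-refl)

  ∑<-suc : ∀ f n → ∑< f (suc n) ≡ f 0 + ∑< (λ t → f (suc t)) n
  ∑<-suc f zero = +-comm 0 (f 0)
  ∑<-suc f (suc n) = trans (cong (_+ f (suc n)) (∑<-suc f n)) (+-assoc (f 0) _ (f (suc n)))

  ∑<-+ : ∀ f g n → ∑< (λ t → f t + g t) n ≡ ∑< f n + ∑< g n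
  ∑<-+ f g zero = refl
  ∑<-+ f g (suc n) = trans (cong (_+ (f n + g n)) (∑<-+ f g n))
    (solve 4 (λ a b c d → (a :+ b) :+ (c :+ d) := (a :+ c) :+ (b :+ d)) refl
           (∑< f n) (∑< g n) (f n) (g n))

  ∑<-*ˡ : ∀ k f n → ∑< (λ t → k * f t) n ≡ k * ∑< f n
  ∑<-*ˡ k f zero = sym (*-zeroʳ k)
  ∑<-*ˡ k f (suc n) = trans (cong (_+ k * f n) (∑<-*ˡ k f n)) (sym (*-distribˡ-+ k (∑< f n) (f n)))

  ∑<-const : ∀ c n → ∑< (λ _ → c) n ≡ n * c
  ∑<-const c zero = refl
  ∑<-const c (suc n) = trans (cong (_+ c) (∑<-const c n)) (+-comm (n * c) c)

module FiniteCounting where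

  open import Level using (Level; _⊔_)
  open import Data.Nat using (ℕ; zero; suc; _+_; _*_; _≤_; _<_; z≤n; s≤s)
  open import Data.Nat.Properties using (≤-antisym; <-irrefl; ≤-refl; ≤-trans; n≤1+n; m≤n⇒m<n∨m≡n)
  open import Data.List using (List; []; _∷_; length; map; _++_; [_]; cartesianProduct; filter)
  open import Data.List.Properties using (length-map; length-++)
  open import Data.List.Relation.Unary.All as All using (All; []; _∷_)
  import Data.List.Relation.Unary.All.Properties as AllP
  open import Data.List.Relation.Unary.Any using (Any; here; there; any?)
  open import Data.List.Relation.Unary.AllPairs using ([]; _∷_)
  import Data.List.Relation.Unary.Unique.Setoid.Properties as UniqueP
  import Data.List.Membership.Setoid.Properties as MemP
  open import Data.Product using (Σ; _×_; _,_; proj₁; proj₂)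
  open import Data.Product.Relation.Binary.Pointwise.NonDependent using (_×ₛ_)
  open import Data.Sum using (_⊎_; inj₁; inj₂)
  open import Data.Unit.Polymorphic using (⊤)
  open import Relation.Binary.Bundles using (Setoid)
  open import Relation.Binary.Definitions using (Decidable)
  import Relation.Binary.PropositionalEquality as ≡
  open ≡ using (_≡_; cong; cong₂; subst)
  open import Relation.Nullary using (¬_; Dec; yes; no; contradiction)
  import Relation.Unary as U
  open import Defs using (HasCard)
  open Sums using (∑<)

  private variable
    a b p p′ ℓ₁ ℓ₂ : Level

  length-cartesianProduct : ∀ {A : Set a} {B : Set b} (xs : List A) (ys : List B) →
    length (cartesianProduct xs ys) ≡ length xs * length ys
  length-cartesianProduct [] ys = ≡.refl
  length-cartesianProduct (x ∷ xs) ys = ≡.trans (length-++ (map (x ,_) ys))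
    (cong₂ _+_ (length-map (x ,_) ys) (length-cartesianProduct xs ys))

  module OneSetoid (S : Setoid a ℓ₁) where
    open Setoid S renaming (Carrier to A)
    open import Data.List.Membership.Setoid S using (_∈_)
    open import Data.List.Relation.Unary.Unique.Setoid S using (Unique)

    private
      delete : ∀ {z ys} → z ∈ ys → List A
      delete {ys = _ ∷ ys} (here _) = ys
      delete {ys = y ∷ _} (there z∈ys) = y ∷ delete z∈ys

      length-delete : ∀ {z ys} (z∈ys : z ∈ ys) → suc (length (delete z∈ys)) ≡ length ys
      length-delete (here _) = ≡.refl
      length-delete (there z∈ys) = cong suc (length-delete z∈ys)

      ∈-delete : ∀ {z w ys} (z∈ys : z ∈ ys) → w ∈ ys → ¬ (z ≈ w) → w ∈ delete z∈ys
      ∈-delete (here z≈y) (here w≈y) z≉w = contradiction (trans z≈y (sym w≈y)) z≉w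
      ∈-delete (here _) (there w∈ys) _ = w∈ys
      ∈-delete (there _) (here w≈y) _ = here w≈y
      ∈-delete (there z∈ys) (there w∈ys) z≉w = there (∈-delete z∈ys w∈ys z≉w)

    unique-⊆-length : ∀ xs ys → Unique xs → All (_∈ ys) xs → length xs ≤ length ys
    unique-⊆-length [] ys _ _ = z≤n
    unique-⊆-length (x ∷ xs) ys (x≉xs ∷ xs!) (x∈ys ∷ xs⊆ys) =
      subst (suc (length xs) ≤_) (length-delete x∈ys)
        (s≤s (unique-⊆-length xs (delete x∈ys) xs! (All.zipWith shrink (x≉xs , xs⊆ys))))
      where
      shrink : ∀ {w} → ¬ (x ≈ w) × w ∈ ys → w ∈ delete x∈ys
      shrink (x≉w , w∈ys) = ∈-delete x∈ys w∈ys x≉w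

    card-unique : ∀ {P : A → Set p} {N M} → HasCard _≈_ P N → HasCard _≈_ P M → N ≡ M
    card-unique (xs , ≡.refl , Pxs , xs! , xs-all) (ys , ≡.refl , Pys , ys! , ys-all) = ≤-antisym
      (unique-⊆-length xs ys xs! (All.map (ys-all _) Pxs))
      (unique-⊆-length ys xs ys! (All.map (xs-all _) Pys))

    -- A finite setoid has decidable equality: locate both elements in the enumeration.
    finite⇒decidable : ∀ {N} → HasCard _≈_ (λ _ → ⊤ {ℓ = p}) N → Decidable _≈_
    finite⇒decidable (xs , _ , _ , xs! , xs-all) x y = compare xs! (xs-all x _) (xs-all y _)
      where
      not-in : ∀ {e es z} → All (λ w → ¬ (e ≈ w)) es → z ≈ e → ¬ (z ∈ es)
      not-in (e≉w ∷ _) z≈e (here z≈w) = e≉w (trans (sym z≈e) z≈w)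
      not-in (_ ∷ e≉es) z≈e (there z∈es) = not-in e≉es z≈e z∈es
      compare : ∀ {es} → Unique es → x ∈ es → y ∈ es → Dec (x ≈ y)
      compare _ (here x≈e) (here y≈e) = yes (trans x≈e (sym y≈e))
      compare (e≉es ∷ _) (here x≈e) (there y∈es) = no (λ x≈y → not-in e≉es (trans (sym x≈y) x≈e) y∈es)
      compare (e≉es ∷ _) (there x∈es) (here y≈e) = no (λ x≈y → not-in e≉es (trans x≈y y≈e) x∈es)
      compare (_ ∷ es!) (there x∈es) (there y∈es) = compare es! x∈es y∈es

    card-⇔ : ∀ {P : A → Set p} {Q : A → Set p′} → (∀ x → P x → Q x) → (∀ x → Q x → P x) →
      ∀ {N} → HasCard _≈_ P N → HasCard _≈_ Q N
    card-⇔ P⇒Q Q⇒P (xs , len , Pxs , xs! , xs-all) =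
      xs , len , All.map (P⇒Q _) Pxs , xs! , λ x Qx → xs-all x (Q⇒P x Qx)

    card-∅ : ∀ {P : A → Set p} → (∀ x → ¬ P x) → HasCard _≈_ P 0
    card-∅ ¬P = [] , ≡.refl , [] , [] , λ x Px → contradiction Px (¬P x)

    card-single : ∀ {P : A → Set p} (x₀ : A) → P x₀ → (∀ x → P x → x ≈ x₀) → HasCard _≈_ P 1
    card-single x₀ Px₀ P⇒≈x₀ = [ x₀ ] , ≡.refl , Px₀ ∷ [] , [] ∷ [] , λ x Px → here (P⇒≈x₀ x Px)

    card-⊎ : ∀ {P : A → Set p} {Q : A → Set p′} → (∀ x y → P x → Q y → ¬ (x ≈ y)) →
      ∀ {N M} → HasCard _≈_ P N → HasCard _≈_ Q M → HasCard _≈_ (λ x → P x ⊎ Q x) (N + M)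
    card-⊎ apart (xs , ≡.refl , Pxs , xs! , xs-all) (ys , ≡.refl , Qys , ys! , ys-all) =
      xs ++ ys , length-++ xs ,
      AllP.++⁺ (All.map inj₁ Pxs) (All.map inj₂ Qys) ,
      UniqueP.++⁺ S xs! ys! disjoint ,
      λ { x (inj₁ Px) → MemP.∈-++⁺ˡ S (xs-all x Px) ; x (inj₂ Qx) → MemP.∈-++⁺ʳ S xs (ys-all x Qx) }
      where
      disjoint : ∀ {v} → ¬ (v ∈ xs × v ∈ ys)
      disjoint (v∈xs , v∈ys) with All.lookupAny Pxs v∈xs | All.lookupAny Qys v∈ys
      ... | Px , v≈x | Qy , v≈y = apart _ _ Px Qy (trans (sym v≈x) v≈y)

    card-⋃ : ∀ (F : ℕ → A → Set p) (c : ℕ → ℕ) → (∀ t → HasCard _≈_ (F t) (c t)) →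
      (∀ t t′ x y → F t x → F t′ y → x ≈ y → t ≡ t′) →
      ∀ n → HasCard _≈_ (λ x → Σ ℕ λ t → t < n × F t x) (∑< c n)
    card-⋃ F c F-card F-apart zero = card-∅ (λ { x (t , () , _) })
    card-⋃ F c F-card F-apart (suc n) =
      card-⇔ merge split (card-⊎ apart (card-⋃ F c F-card F-apart n) (F-card n))
      where
      merge : ∀ x → (Σ ℕ λ t → t < n × F t x) ⊎ F n x → Σ ℕ λ t → t < suc n × F t x
      merge x (inj₁ (t , t<n , Ftx)) = t , ≤-trans t<n (n≤1+n _) , Ftx
      merge x (inj₂ Fnx) = n , ≤-refl , Fnx
      split : ∀ x → (Σ ℕ λ t → t < suc n × F t x) → (Σ ℕ λ t → t < n × F t x) ⊎ F n x
      split x (t , s≤s t≤n , Ftx) with m≤n⇒m<n∨m≡n t≤n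
      ... | inj₁ t<n = inj₁ (t , t<n , Ftx)
      ... | inj₂ ≡.refl = inj₂ Ftx
      apart : ∀ x y → (Σ ℕ λ t → t < n × F t x) → F n y → ¬ (x ≈ y)
      apart x y (t , t<n , Ftx) Fny x≈y with F-apart t n x y Ftx Fny x≈y
      ... | ≡.refl = <-irrefl ≡.refl t<n

    card-filter : ∀ {P : A → Set p} {Q : A → Set p′} (Q? : U.Decidable Q) → (∀ {x y} → x ≈ y → Q x → Q y) →
      ∀ {N} → HasCard _≈_ P N → Σ ℕ λ M → HasCard _≈_ (λ x → P x × Q x) M
    card-filter Q? Q-resp (xs , _ , Pxs , xs! , xs-all) =
      _ , filter Q? xs , ≡.refl ,
      All.zip (AllP.filter⁺ Q? Pxs , AllP.all-filter Q? xs) ,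
      UniqueP.filter⁺ S Q? xs! ,
      λ x (Px , Qx) → MemP.∈-filter⁺ S Q? Q-resp (xs-all x Px) Qx

  module TwoSetoids (S : Setoid a ℓ₁) (T : Setoid b ℓ₂) where
    open Setoid S using () renaming (Carrier to A; _≈_ to _≈₁_)
    open Setoid T using () renaming (Carrier to B; _≈_ to _≈₂_; sym to sym₂; trans to trans₂)
    open import Data.List.Membership.Setoid T using () renaming (_∈_ to _∈₂_)
    open import Data.List.Relation.Unary.Unique.Setoid S using () renaming (Unique to Unique₁)
    open import Data.List.Relation.Unary.Unique.Setoid T using () renaming (Unique to Unique₂)

    InjectiveOn : (A → Set p) → (A → B) → Set (a ⊔ ℓ₁ ⊔ ℓ₂ ⊔ p)
    InjectiveOn P f = ∀ x y → P x → P y → f x ≈₂ f y → x ≈₁ y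

    Congruent : (A → B) → Set (a ⊔ ℓ₁ ⊔ ℓ₂)
    Congruent f = ∀ {x y} → x ≈₁ y → f x ≈₂ f y

    OntoOn : (A → Set p) → (B → Set p′) → (A → B) → Set (a ⊔ b ⊔ ℓ₂ ⊔ p ⊔ p′)
    OntoOn P Q f = ∀ y → Q y → Σ A λ x → P x × f x ≈₂ y

    private
      unique-map : ∀ {P : A → Set p} {f} → InjectiveOn P f →
        ∀ {xs} → All P xs → Unique₁ xs → Unique₂ (map f xs)
      unique-map inj [] [] = []
      unique-map {P = P} {f} inj (Px ∷ Pxs) (x≉xs ∷ xs!) = apart Pxs x≉xs ∷ unique-map inj Pxs xs!
        where
        apart : ∀ {ys} → All P ys → All (λ y → ¬ (_ ≈₁ y)) ys → All (λ z → ¬ (f _ ≈₂ z)) (map f ys)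
        apart [] [] = []
        apart (Py ∷ Pys) (x≉y ∷ x≉ys) = (λ fx≈fy → x≉y (inj _ _ Px Py fx≈fy)) ∷ apart Pys x≉ys

    card-image : ∀ {P : A → Set p} {Q : B → Set p′} (f : A → B) → Congruent f →
      InjectiveOn P f → (∀ x → P x → Q (f x)) → OntoOn P Q f →
      ∀ {N} → HasCard _≈₁_ P N → HasCard _≈₂_ Q N
    card-image {Q = Q} f f-cong f-inj P⇒Q onto (xs , len , Pxs , xs! , xs-all) =
      map f xs , ≡.trans (length-map f xs) len ,
      AllP.map⁺ (All.map (P⇒Q _) Pxs) , unique-map f-inj Pxs xs! , complete
      where
      complete : ∀ y → Q y → y ∈₂ map f xs
      complete y Qy with onto y Qy
      ... | x , Px , fx≈y = MemP.∈-resp-≈ T fx≈y (MemP.∈-map⁺ S T f-cong (xs-all x Px))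

    card-preimage : ∀ {p p′} {P : A → Set p} {Q : B → Set p′} (g : A → B) → Congruent g →
      InjectiveOn P g → (∀ x → P x → Q (g x)) → OntoOn P Q g →
      ∀ {N} → HasCard _≈₂_ Q N → HasCard _≈₁_ P N
    card-preimage {p = p} {P = P} g g-cong g-inj P⇒Q onto (ys , len , Qys , ys! , ys-all) =
      preimages pre , ≡.trans (length-preimages pre) len , All-P pre , unique pre ys! ,
      λ x Px → complete x Px pre (ys-all (g x) (P⇒Q x Px))
      where
      Fibre : B → Set (a ⊔ ℓ₂ ⊔ p)
      Fibre y = Σ A λ x → P x × g x ≈₂ y
      pre : All Fibre ys
      pre = All.map (onto _) Qys
      preimages : ∀ {zs} → All Fibre zs → List A
      preimages [] = []
      preimages ((x , _) ∷ fs) = x ∷ preimages fs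
      length-preimages : ∀ {zs} (fs : All Fibre zs) → length (preimages fs) ≡ length zs
      length-preimages [] = ≡.refl
      length-preimages (_ ∷ fs) = cong suc (length-preimages fs)
      All-P : ∀ {zs} (fs : All Fibre zs) → All P (preimages fs)
      All-P [] = []
      All-P ((_ , Px , _) ∷ fs) = Px ∷ All-P fs
      apart : ∀ {y zs} (f : Fibre y) (fs : All Fibre zs) → All (λ z → ¬ (y ≈₂ z)) zs →
        All (λ x′ → ¬ (proj₁ f ≈₁ x′)) (preimages fs)
      apart _ [] [] = []
      apart f@(x , _ , gx≈y) ((x′ , _ , gx′≈z) ∷ fs) (y≉z ∷ y≉zs) =
        (λ x≈x′ → y≉z (trans₂ (sym₂ gx≈y) (trans₂ (g-cong x≈x′) gx′≈z))) ∷ apart f fs y≉zs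
      unique : ∀ {zs} (fs : All Fibre zs) → Unique₂ zs → Unique₁ (preimages fs)
      unique [] [] = []
      unique (f ∷ fs) (y≉zs ∷ zs!) = apart f fs y≉zs ∷ unique fs zs!
      complete : ∀ x → P x → ∀ {zs} (fs : All Fibre zs) → g x ∈₂ zs → Any (x ≈₁_) (preimages fs)
      complete x Px ((x′ , Px′ , gx′≈y) ∷ fs) (here gx≈y) = here (g-inj x x′ Px Px′ (trans₂ gx≈y (sym₂ gx′≈y)))
      complete x Px (_ ∷ fs) (there gx∈zs) = there (complete x Px fs gx∈zs)

    card-× : ∀ {P : A → Set p} {Q : B → Set p′} {N M} → HasCard _≈₁_ P N → HasCard _≈₂_ Q M →
      HasCard (Setoid._≈_ (S ×ₛ T)) (λ u → P (proj₁ u) × Q (proj₂ u)) (N * M)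
    card-× (xs , ≡.refl , Pxs , xs! , xs-all) (ys , ≡.refl , Qys , ys! , ys-all) =
      cartesianProduct xs ys , length-cartesianProduct xs ys ,
      AllP.cartesianProduct⁺ (≡.setoid A) (≡.setoid B) xs ys
        (λ x∈xs y∈ys → All.lookup Pxs x∈xs , All.lookup Qys y∈ys) ,
      UniqueP.cartesianProduct⁺ S T xs! ys! ,
      λ (x , y) (Px , Qy) → MemP.∈-cartesianProduct⁺ S T (xs-all x Px) (ys-all y Qy)

    injective⇒onto : Decidable _≈₂_ → ∀ {P : A → Set p} {Q : B → Set p′} (f : A → B) →
      InjectiveOn P f → (∀ x → P x → Q (f x)) →
      ∀ {N} → HasCard _≈₁_ P N → HasCard _≈₂_ Q N → OntoOn P Q f
    injective⇒onto _≟₂_ {P} f f-inj P⇒Q (xs , lenxs , Pxs , xs! , _) (ys , lenys , _ , _ , ys-all) y Qy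
      with any? (λ x → f x ≟₂ y) xs
    ... | yes fx≈y = _ , All.lookupAny Pxs fx≈y
    ... | no ¬fx≈y = contradiction (subst (_≤ length ys) same-length too-long) (<-irrefl ≡.refl)
      where
      y∉ : ∀ zs → ¬ Any (λ x → f x ≈₂ y) zs → All (λ z → ¬ (y ≈₂ z)) (map f zs)
      y∉ [] _ = []
      y∉ (z ∷ zs) ¬any = (λ y≈fz → ¬any (here (sym₂ y≈fz))) ∷ y∉ zs (λ a → ¬any (there a))
      too-long : length (y ∷ map f xs) ≤ length ys
      too-long = OneSetoid.unique-⊆-length T (y ∷ map f xs) ys
        (y∉ xs ¬fx≈y ∷ unique-map f-inj Pxs xs!)
        (ys-all y Qy ∷ AllP.map⁺ (All.map (λ {x} Px → ys-all (f x) (P⇒Q x Px)) Pxs))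
      same-length : length (y ∷ map f xs) ≡ suc (length ys)
      same-length = cong suc (≡.trans (length-map f xs) (≡.trans lenxs (≡.sym lenys)))

module Polynomials where

  open import Level using (Level; _⊔_)
  open import Algebra.Bundles using (CommutativeRing)
  import Algebra.Properties.CommutativeSemigroup as CommSemigroupProps
  open import Data.Nat using (ℕ; zero; suc)
  open import Data.List using ([]; _∷_; map; [_])
  open import Relation.Binary.Bundles using (Setoid)
  import Relation.Binary.Reasoning.Setoid as SetoidReasoning
  import Defs
  open Defs using ([]≋[]; []≋∷; ∷≋[]; ∷≋∷)

  -- Coefficient lists over a commutative ring form a commutative semiring up to _≋_.
  -- Every law is reduced to the ring laws coefficientwise via 'coeff'.
  module PolyRing {c ℓ : Level} (R : CommutativeRing c ℓ) where
    open CommutativeRing R public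

    Poly : Set c
    Poly = Defs.Poly R

    infix 4 _≋_
    _≋_ : Poly → Poly → Set (c ⊔ ℓ)
    _≋_ = Defs._≋_ R

    infixl 6 _+ₚ_
    _+ₚ_ : Poly → Poly → Poly
    _+ₚ_ = Defs._+ₚ_ R

    infixl 7 _*ₚ_
    _*ₚ_ : Poly → Poly → Poly
    _*ₚ_ = Defs._*ₚ_ R

    -- The i-th coefficient; a list is padded with zeros.
    coeff : Poly → ℕ → Carrier
    coeff [] _ = 0#
    coeff (x ∷ p) zero = x
    coeff (x ∷ p) (suc i) = coeff p i

    ≋⇒coeff : ∀ {p q} → p ≋ q → ∀ i → coeff p i ≈ coeff q i
    ≋⇒coeff []≋[] i = refl
    ≋⇒coeff ([]≋∷ y≈0 _) zero = sym y≈0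
    ≋⇒coeff ([]≋∷ _ r) (suc i) = ≋⇒coeff r i
    ≋⇒coeff (∷≋[] x≈0 _) zero = x≈0
    ≋⇒coeff (∷≋[] _ r) (suc i) = ≋⇒coeff r i
    ≋⇒coeff (∷≋∷ x≈y _) zero = x≈y
    ≋⇒coeff (∷≋∷ _ r) (suc i) = ≋⇒coeff r i

    coeff⇒≋ : ∀ {p q} → (∀ i → coeff p i ≈ coeff q i) → p ≋ q
    coeff⇒≋ {[]} {[]} h = []≋[]
    coeff⇒≋ {[]} {y ∷ q} h = []≋∷ (sym (h 0)) (coeff⇒≋ (λ i → h (suc i)))
    coeff⇒≋ {x ∷ p} {[]} h = ∷≋[] (h 0) (coeff⇒≋ (λ i → h (suc i)))
    coeff⇒≋ {x ∷ p} {y ∷ q} h = ∷≋∷ (h 0) (coeff⇒≋ (λ i → h (suc i)))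

    ≋-refl : ∀ {p} → p ≋ p
    ≋-refl = coeff⇒≋ (λ _ → refl)

    ≋-sym : ∀ {p q} → p ≋ q → q ≋ p
    ≋-sym e = coeff⇒≋ (λ i → sym (≋⇒coeff e i))

    ≋-trans : ∀ {p q r} → p ≋ q → q ≋ r → p ≋ r
    ≋-trans e f = coeff⇒≋ (λ i → trans (≋⇒coeff e i) (≋⇒coeff f i))

    ≋-setoid : Setoid c (c ⊔ ℓ)
    ≋-setoid = record
      { Carrier = Poly ; _≈_ = _≋_
      ; isEquivalence = record { refl = ≋-refl ; sym = ≋-sym ; trans = ≋-trans } }

    scale : Carrier → Poly → Poly
    scale a p = map (a *_) p

    shift : Poly → Poly
    shift p = 0# ∷ p

    coeff-+ₚ : ∀ p q i → coeff (p +ₚ q) i ≈ coeff p i + coeff q i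
    coeff-+ₚ [] q i = sym (+-identityˡ _)
    coeff-+ₚ (x ∷ p) [] i = sym (+-identityʳ _)
    coeff-+ₚ (x ∷ p) (y ∷ q) zero = refl
    coeff-+ₚ (x ∷ p) (y ∷ q) (suc i) = coeff-+ₚ p q i

    coeff-scale : ∀ a p i → coeff (scale a p) i ≈ a * coeff p i
    coeff-scale a [] i = sym (zeroʳ a)
    coeff-scale a (x ∷ p) zero = refl
    coeff-scale a (x ∷ p) (suc i) = coeff-scale a p i

    module _ where
      open SetoidReasoning setoid
      open CommSemigroupProps +-commutativeSemigroup using (interchange)

      +ₚ-cong : ∀ {p p′ q q′} → p ≋ p′ → q ≋ q′ → p +ₚ q ≋ p′ +ₚ q′
      +ₚ-cong {p} {p′} {q} {q′} e f = coeff⇒≋ λ i → begin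
        coeff (p +ₚ q) i          ≈⟨ coeff-+ₚ p q i ⟩
        coeff p i + coeff q i     ≈⟨ +-cong (≋⇒coeff e i) (≋⇒coeff f i) ⟩
        coeff p′ i + coeff q′ i   ≈⟨ coeff-+ₚ p′ q′ i ⟨
        coeff (p′ +ₚ q′) i        ∎

      +ₚ-comm : ∀ p q → p +ₚ q ≋ q +ₚ p
      +ₚ-comm p q = coeff⇒≋ λ i → trans (coeff-+ₚ p q i) (trans (+-comm _ _) (sym (coeff-+ₚ q p i)))

      +ₚ-assoc : ∀ p q r → p +ₚ q +ₚ r ≋ p +ₚ (q +ₚ r)
      +ₚ-assoc p q r = coeff⇒≋ λ i → begin
        coeff (p +ₚ q +ₚ r) i                 ≈⟨ trans (coeff-+ₚ (p +ₚ q) r i) (+-congʳ (coeff-+ₚ p q i)) ⟩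
        coeff p i + coeff q i + coeff r i     ≈⟨ +-assoc _ _ _ ⟩
        coeff p i + (coeff q i + coeff r i)   ≈⟨ trans (coeff-+ₚ p (q +ₚ r) i) (+-congˡ (coeff-+ₚ q r i)) ⟨
        coeff (p +ₚ (q +ₚ r)) i               ∎

      +ₚ-identityʳ : ∀ p → p +ₚ [] ≋ p
      +ₚ-identityʳ p = coeff⇒≋ λ i → trans (coeff-+ₚ p [] i) (+-identityʳ _)

      +ₚ-interchange : ∀ p q r s → (p +ₚ q) +ₚ (r +ₚ s) ≋ (p +ₚ r) +ₚ (q +ₚ s)
      +ₚ-interchange p q r s = coeff⇒≋ λ i → begin
        coeff ((p +ₚ q) +ₚ (r +ₚ s)) i
          ≈⟨ trans (coeff-+ₚ (p +ₚ q) (r +ₚ s) i) (+-cong (coeff-+ₚ p q i) (coeff-+ₚ r s i)) ⟩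
        (coeff p i + coeff q i) + (coeff r i + coeff s i)
          ≈⟨ interchange _ _ _ _ ⟩
        (coeff p i + coeff r i) + (coeff q i + coeff s i)
          ≈⟨ trans (coeff-+ₚ (p +ₚ r) (q +ₚ s) i) (+-cong (coeff-+ₚ p r i) (coeff-+ₚ q s i)) ⟨
        coeff ((p +ₚ r) +ₚ (q +ₚ s)) i ∎

      scale-cong : ∀ {a b p q} → a ≈ b → p ≋ q → scale a p ≋ scale b q
      scale-cong {a} {b} {p} {q} a≈b e = coeff⇒≋ λ i →
        trans (coeff-scale a p i) (trans (*-cong a≈b (≋⇒coeff e i)) (sym (coeff-scale b q i)))

      scale-+ₚ : ∀ a p q → scale a (p +ₚ q) ≋ scale a p +ₚ scale a q
      scale-+ₚ a p q = coeff⇒≋ λ i → begin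
        coeff (scale a (p +ₚ q)) i        ≈⟨ trans (coeff-scale a (p +ₚ q) i) (*-congˡ (coeff-+ₚ p q i)) ⟩
        a * (coeff p i + coeff q i)       ≈⟨ distribˡ _ _ _ ⟩
        a * coeff p i + a * coeff q i     ≈⟨ trans (coeff-+ₚ (scale a p) (scale a q) i) (+-cong (coeff-scale a p i) (coeff-scale a q i)) ⟨
        coeff (scale a p +ₚ scale a q) i  ∎

      scale-+ : ∀ a b p → scale (a + b) p ≋ scale a p +ₚ scale b p
      scale-+ a b p = coeff⇒≋ λ i → begin
        coeff (scale (a + b) p) i         ≈⟨ coeff-scale (a + b) p i ⟩
        (a + b) * coeff p i               ≈⟨ distribʳ _ _ _ ⟩
        a * coeff p i + b * coeff p i     ≈⟨ trans (coeff-+ₚ (scale a p) (scale b p) i) (+-cong (coeff-scale a p i) (coeff-scale b p i)) ⟨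
        coeff (scale a p +ₚ scale b p) i  ∎

      scale-scale : ∀ a b p → scale a (scale b p) ≋ scale (a * b) p
      scale-scale a b p = coeff⇒≋ λ i → begin
        coeff (scale a (scale b p)) i   ≈⟨ trans (coeff-scale a (scale b p) i) (*-congˡ (coeff-scale b p i)) ⟩
        a * (b * coeff p i)             ≈⟨ *-assoc _ _ _ ⟨
        a * b * coeff p i               ≈⟨ coeff-scale (a * b) p i ⟨
        coeff (scale (a * b) p) i       ∎

      scale-0 : ∀ p → scale 0# p ≋ []
      scale-0 p = coeff⇒≋ λ i → trans (coeff-scale 0# p i) (zeroˡ _)

      scale-1 : ∀ p → scale 1# p ≋ p
      scale-1 p = coeff⇒≋ λ i → trans (coeff-scale 1# p i) (*-identityˡ _)

    module _ where
      open SetoidReasoning ≋-setoid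

      shift-cong : ∀ {p q} → p ≋ q → shift p ≋ shift q
      shift-cong = ∷≋∷ refl

      shift-+ₚ : ∀ p q → shift p +ₚ shift q ≋ shift (p +ₚ q)
      shift-+ₚ p q = ∷≋∷ (+-identityˡ _) ≋-refl

      scale-shift : ∀ a p → scale a (shift p) ≋ shift (scale a p)
      scale-shift a p = ∷≋∷ (zeroʳ a) ≋-refl

      shift-[] : shift [] ≋ []
      shift-[] = ∷≋[] refl []≋[]

      *ₚ-zeroʳ : ∀ p → p *ₚ [] ≋ []
      *ₚ-zeroʳ [] = []≋[]
      *ₚ-zeroʳ (a ∷ p) = ∷≋[] refl (*ₚ-zeroʳ p)

      *ₚ-congʳ : ∀ p {q q′} → q ≋ q′ → p *ₚ q ≋ p *ₚ q′
      *ₚ-congʳ [] e = []≋[]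
      *ₚ-congʳ (a ∷ p) e = +ₚ-cong (scale-cong refl e) (shift-cong (*ₚ-congʳ p e))

      private
        *ₚ-zero-head : ∀ {a} p → a ≈ 0# → ∀ q → (a ∷ p) *ₚ q ≋ shift (p *ₚ q)
        *ₚ-zero-head {a} p a≈0 q = begin
          scale a q +ₚ shift (p *ₚ q)     ≈⟨ +ₚ-cong (≋-trans (scale-cong a≈0 ≋-refl) (scale-0 q)) ≋-refl ⟩
          [] +ₚ shift (p *ₚ q)            ≡⟨⟩
          shift (p *ₚ q)                  ∎

      *ₚ-congˡ : ∀ {p p′} → p ≋ p′ → ∀ q → p *ₚ q ≋ p′ *ₚ q
      *ₚ-congˡ []≋[] q = ≋-refl
      *ₚ-congˡ ([]≋∷ {ys = ys} y≈0 r) q =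
        ≋-sym (≋-trans (*ₚ-zero-head ys y≈0 q) (≋-trans (shift-cong (≋-sym (*ₚ-congˡ r q))) shift-[]))
      *ₚ-congˡ (∷≋[] {xs = xs} x≈0 r) q =
        ≋-trans (*ₚ-zero-head xs x≈0 q) (≋-trans (shift-cong (*ₚ-congˡ r q)) shift-[])
      *ₚ-congˡ (∷≋∷ x≈y r) q = +ₚ-cong (scale-cong x≈y ≋-refl) (shift-cong (*ₚ-congˡ r q))

      *ₚ-cong : ∀ {p p′ q q′} → p ≋ p′ → q ≋ q′ → p *ₚ q ≋ p′ *ₚ q′
      *ₚ-cong {p′ = p′} {q} e f = ≋-trans (*ₚ-congˡ e q) (*ₚ-congʳ p′ f)

      *ₚ-scaleʳ : ∀ p a q → p *ₚ scale a q ≋ scale a (p *ₚ q)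
      *ₚ-scaleʳ [] a q = []≋[]
      *ₚ-scaleʳ (b ∷ p) a q = begin
        scale b (scale a q) +ₚ shift (p *ₚ scale a q)
          ≈⟨ +ₚ-cong (≋-trans (scale-scale b a q) (≋-trans (scale-cong (*-comm b a) ≋-refl) (≋-sym (scale-scale a b q))))
                     (≋-trans (shift-cong (*ₚ-scaleʳ p a q)) (≋-sym (scale-shift a (p *ₚ q)))) ⟩
        scale a (scale b q) +ₚ scale a (shift (p *ₚ q))
          ≈⟨ scale-+ₚ a (scale b q) (shift (p *ₚ q)) ⟨
        scale a (scale b q +ₚ shift (p *ₚ q)) ∎

      *ₚ-scaleˡ : ∀ a p q → scale a p *ₚ q ≋ scale a (p *ₚ q)
      *ₚ-scaleˡ a [] q = []≋[]
      *ₚ-scaleˡ a (b ∷ p) q = begin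
        scale (a * b) q +ₚ shift (scale a p *ₚ q)
          ≈⟨ +ₚ-cong (≋-sym (scale-scale a b q)) (≋-trans (shift-cong (*ₚ-scaleˡ a p q)) (≋-sym (scale-shift a (p *ₚ q)))) ⟩
        scale a (scale b q) +ₚ scale a (shift (p *ₚ q))
          ≈⟨ scale-+ₚ a (scale b q) (shift (p *ₚ q)) ⟨
        scale a (scale b q +ₚ shift (p *ₚ q)) ∎

      *ₚ-shiftʳ : ∀ p q → p *ₚ shift q ≋ shift (p *ₚ q)
      *ₚ-shiftʳ [] q = ≋-sym shift-[]
      *ₚ-shiftʳ (a ∷ p) q = begin
        scale a (shift q) +ₚ shift (p *ₚ shift q)      ≈⟨ +ₚ-cong (scale-shift a q) (shift-cong (*ₚ-shiftʳ p q)) ⟩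
        shift (scale a q) +ₚ shift (shift (p *ₚ q))    ≈⟨ shift-+ₚ (scale a q) (shift (p *ₚ q)) ⟩
        shift (scale a q +ₚ shift (p *ₚ q))            ∎

      *ₚ-distribʳ : ∀ p q r → (p +ₚ q) *ₚ r ≋ p *ₚ r +ₚ q *ₚ r
      *ₚ-distribʳ [] q r = ≋-refl
      *ₚ-distribʳ (a ∷ p) [] r = ≋-sym (+ₚ-identityʳ _)
      *ₚ-distribʳ (a ∷ p) (b ∷ q) r = begin
        scale (a + b) r +ₚ shift ((p +ₚ q) *ₚ r)
          ≈⟨ +ₚ-cong (scale-+ a b r) (≋-trans (shift-cong (*ₚ-distribʳ p q r)) (≋-sym (shift-+ₚ (p *ₚ r) (q *ₚ r)))) ⟩
        (scale a r +ₚ scale b r) +ₚ (shift (p *ₚ r) +ₚ shift (q *ₚ r))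
          ≈⟨ +ₚ-interchange (scale a r) (scale b r) (shift (p *ₚ r)) (shift (q *ₚ r)) ⟩
        (scale a r +ₚ shift (p *ₚ r)) +ₚ (scale b r +ₚ shift (q *ₚ r)) ∎

      *ₚ-distribˡ : ∀ p q r → p *ₚ (q +ₚ r) ≋ p *ₚ q +ₚ p *ₚ r
      *ₚ-distribˡ [] q r = []≋[]
      *ₚ-distribˡ (a ∷ p) q r = begin
        scale a (q +ₚ r) +ₚ shift (p *ₚ (q +ₚ r))
          ≈⟨ +ₚ-cong (scale-+ₚ a q r) (≋-trans (shift-cong (*ₚ-distribˡ p q r)) (≋-sym (shift-+ₚ (p *ₚ q) (p *ₚ r)))) ⟩
        (scale a q +ₚ scale a r) +ₚ (shift (p *ₚ q) +ₚ shift (p *ₚ r))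
          ≈⟨ +ₚ-interchange (scale a q) (scale a r) (shift (p *ₚ q)) (shift (p *ₚ r)) ⟩
        (scale a q +ₚ shift (p *ₚ q)) +ₚ (scale a r +ₚ shift (p *ₚ r)) ∎

      *ₚ-constʳ : ∀ p b → p *ₚ [ b ] ≋ scale b p
      *ₚ-constʳ [] b = []≋[]
      *ₚ-constʳ (a ∷ p) b = ∷≋∷ (trans (+-identityʳ _) (*-comm a b)) (*ₚ-constʳ p b)

      *ₚ-identityʳ : ∀ p → p *ₚ [ 1# ] ≋ p
      *ₚ-identityʳ p = ≋-trans (*ₚ-constʳ p 1#) (scale-1 p)

      *ₚ-identityˡ : ∀ p → [ 1# ] *ₚ p ≋ p
      *ₚ-identityˡ p = ≋-trans (+ₚ-cong (scale-1 p) (∷≋[] refl []≋[])) (+ₚ-identityʳ p)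

      *ₚ-comm : ∀ p q → p *ₚ q ≋ q *ₚ p
      *ₚ-comm [] q = ≋-sym (*ₚ-zeroʳ q)
      *ₚ-comm (a ∷ p) q = begin
        scale a q +ₚ shift (p *ₚ q)       ≈⟨ +ₚ-cong (≋-sym (*ₚ-constʳ q a)) (shift-cong (*ₚ-comm p q)) ⟩
        q *ₚ [ a ] +ₚ shift (q *ₚ p)      ≈⟨ +ₚ-cong ≋-refl (≋-sym (*ₚ-shiftʳ q p)) ⟩
        q *ₚ [ a ] +ₚ q *ₚ shift p        ≈⟨ *ₚ-distribˡ q [ a ] (shift p) ⟨
        q *ₚ ([ a ] +ₚ shift p)           ≈⟨ *ₚ-congʳ q (∷≋∷ (+-identityʳ a) ≋-refl) ⟩
        q *ₚ (a ∷ p)                      ∎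

      *ₚ-assoc : ∀ p q r → p *ₚ q *ₚ r ≋ p *ₚ (q *ₚ r)
      *ₚ-assoc [] q r = []≋[]
      *ₚ-assoc (a ∷ p) q r = begin
        (scale a q +ₚ shift (p *ₚ q)) *ₚ r       ≈⟨ *ₚ-distribʳ (scale a q) (shift (p *ₚ q)) r ⟩
        scale a q *ₚ r +ₚ shift (p *ₚ q) *ₚ r    ≈⟨ +ₚ-cong (*ₚ-scaleˡ a q r) (≋-trans (*ₚ-zero-head (p *ₚ q) refl r) (shift-cong (*ₚ-assoc p q r))) ⟩
        scale a (q *ₚ r) +ₚ shift (p *ₚ (q *ₚ r)) ∎

module MonicPolynomials where

  open import Level using (Level; _⊔_)
  open import Algebra.Bundles using (CommutativeRing)
  open import Data.Nat using (ℕ; zero; suc; _≤_; s≤s) renaming (_+_ to _+ᴺ_)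
  open import Data.Nat.Properties using (m≤n+m)
  open import Data.List using (List; []; _∷_; _++_; [_]; length)
  open import Data.List.Properties using (length-map)
  open import Data.Vec as Vec using (Vec; []; _∷_; toList)
  open import Data.Vec.Relation.Binary.Pointwise.Inductive as Pw using (Pointwise; []; _∷_)
  open import Data.Product using (Σ; _×_; _,_; proj₁; map₁)
  open import Data.Empty using (⊥-elim)
  open import Relation.Binary.Bundles using (Setoid)
  import Relation.Binary.PropositionalEquality as ≡
  open ≡ using (_≡_; cong; subst)
  open import Relation.Nullary using (¬_)
  import Defs
  open Defs using ([]≋[]; ∷≋[]; ∷≋∷)
  open Polynomials using (module PolyRing)

  module Monic {c ℓ : Level} (R : CommutativeRing c ℓ) where
    open PolyRing R

    infix 4 _≈ᵥ_
    _≈ᵥ_ : ∀ {k} → Vec Carrier k → Vec Carrier k → Set (c ⊔ ℓ)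
    _≈ᵥ_ = Pointwise _≈_

    ≈ᵥ-setoid : ℕ → Setoid c (c ⊔ ℓ)
    ≈ᵥ-setoid = Pw.setoid setoid

    ≈ᵥ-refl : ∀ {k} {v : Vec Carrier k} → v ≈ᵥ v
    ≈ᵥ-refl = Pw.refl refl

    withTop : ∀ {k} → Vec Carrier k → Carrier → Poly
    withTop v t = toList v ++ [ t ]

    monic : ∀ {k} → Vec Carrier k → Poly
    monic = Defs.monic R

    IsMonicDeg : ℕ → Poly → Set (c ⊔ ℓ)
    IsMonicDeg = Defs.IsMonicDeg R

    monic-IsMonicDeg : ∀ {k} (v : Vec Carrier k) → IsMonicDeg k (monic v)
    monic-IsMonicDeg v = v , ≋-refl

    length-withTop : ∀ {k} (v : Vec Carrier k) t → length (withTop v t) ≡ suc k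
    length-withTop [] t = ≡.refl
    length-withTop (x ∷ v) t = cong suc (length-withTop v t)

    toList-cong : ∀ {k} {v w : Vec Carrier k} → v ≈ᵥ w → toList v ≋ toList w
    toList-cong [] = []≋[]
    toList-cong (x≈y ∷ v≈w) = ∷≋∷ x≈y (toList-cong v≈w)

    withTop-cong : ∀ {k} {v w : Vec Carrier k} {s t} → v ≈ᵥ w → s ≈ t → withTop v s ≋ withTop w t
    withTop-cong [] s≈t = ∷≋∷ s≈t []≋[]
    withTop-cong (x≈y ∷ v≈w) s≈t = ∷≋∷ x≈y (withTop-cong v≈w s≈t)

    monic-cong : ∀ {k} {v w : Vec Carrier k} → v ≈ᵥ w → monic v ≋ monic w
    monic-cong v≈w = withTop-cong v≈w refl

    withTop-injective : ∀ {k} (v w : Vec Carrier k) {s t} → withTop v s ≋ withTop w t → v ≈ᵥ w × s ≈ t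
    withTop-injective [] [] (∷≋∷ s≈t _) = [] , s≈t
    withTop-injective (x ∷ v) (y ∷ w) (∷≋∷ x≈y e) = map₁ (x≈y ∷_) (withTop-injective v w e)

    monic-injective : ∀ {k} (v w : Vec Carrier k) → monic v ≋ monic w → v ≈ᵥ w
    monic-injective v w e = proj₁ (withTop-injective v w e)

    withTop≋[] : ∀ {k} (v : Vec Carrier k) {t} → withTop v t ≋ [] → t ≈ 0#
    withTop≋[] [] (∷≋[] t≈0 _) = t≈0
    withTop≋[] (x ∷ v) (∷≋[] _ e) = withTop≋[] v e

    scale-withTop : ∀ s {j} (w : Vec Carrier j) t → scale s (withTop w t) ≋ withTop (Vec.map (s *_) w) (s * t)
    scale-withTop s [] t = ≋-refl
    scale-withTop s (x ∷ w) t = ∷≋∷ refl (scale-withTop s w t)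

    scaleᵥ : ∀ {k} → Carrier → Vec Carrier k → Vec Carrier k
    scaleᵥ t = Vec.map (t *_)

    scaleᵥ-cong : ∀ {k} {s t} {v w : Vec Carrier k} → s ≈ t → v ≈ᵥ w → scaleᵥ s v ≈ᵥ scaleᵥ t w
    scaleᵥ-cong s≈t = Pw.map⁺ (*-cong s≈t)

    scaleᵥ-inverse : ∀ {k} {s t} (v : Vec Carrier k) → s * t ≈ 1# → scaleᵥ s (scaleᵥ t v) ≈ᵥ v
    scaleᵥ-inverse [] _ = []
    scaleᵥ-inverse (x ∷ v) st≈1 =
      trans (sym (*-assoc _ _ x)) (trans (*-congʳ st≈1) (*-identityˡ x)) ∷ scaleᵥ-inverse v st≈1

    scale-monic : ∀ t {k} (v : Vec Carrier k) → scale t (monic v) ≋ withTop (scaleᵥ t v) t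
    scale-monic t v = ≋-trans (scale-withTop t v 1#) (withTop-cong ≈ᵥ-refl (*-identityʳ t))

    ∷ʳ-cong : ∀ {k} {v w : Vec Carrier k} {s t} → v ≈ᵥ w → s ≈ t → (v Vec.∷ʳ s) ≈ᵥ (w Vec.∷ʳ t)
    ∷ʳ-cong [] s≈t = s≈t ∷ []
    ∷ʳ-cong (x≈y ∷ v≈w) s≈t = x≈y ∷ ∷ʳ-cong v≈w s≈t

    private
      +ₚ-zero : ∀ p → p +ₚ [ 0# ] ≋ p
      +ₚ-zero p = ≋-trans (+ₚ-cong ≋-refl (∷≋[] refl []≋[])) (+ₚ-identityʳ p)


      +ₚ-withTop : ∀ {k} p (v : Vec Carrier k) t → length p ≤ k → Σ (Vec Carrier k) λ u → p +ₚ withTop v t ≋ withTop u t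
      +ₚ-withTop [] v t _ = v , ≋-refl
      +ₚ-withTop (a ∷ p) (x ∷ v) t (s≤s len≤k) with +ₚ-withTop p v t len≤k
      ... | u , e = (a + x) ∷ u , ∷≋∷ refl e

      scale-withTop-length : ∀ x {j} (w : Vec Carrier j) t i → length (scale x (withTop w t)) ≤ suc (i +ᴺ j)
      scale-withTop-length x {j} w t i =
        subst (_≤ suc (i +ᴺ j)) (≡.sym (≡.trans (length-map (x *_) (withTop w t)) (length-withTop w t)))
              (s≤s (m≤n+m j i))

    withTop-*ₚ : ∀ {i j} (v : Vec Carrier i) s (w : Vec Carrier j) t →
      Σ (Vec Carrier (i +ᴺ j)) λ u → withTop v s *ₚ withTop w t ≋ withTop u (s * t)
    withTop-*ₚ [] s w t = Vec.map (s *_) w , ≋-trans (+ₚ-zero _) (scale-withTop s w t)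
    withTop-*ₚ {suc i} {j} (x ∷ v) s w t with withTop-*ₚ v s w t
    ... | u , e with +ₚ-withTop (scale x (withTop w t)) (0# ∷ u) (s * t) (scale-withTop-length x w t i)
    ...   | u′ , e′ = u′ , ≋-trans (+ₚ-cong ≋-refl (shift-cong e)) e′

    monic-*ₚ : ∀ {i j} (v : Vec Carrier i) (w : Vec Carrier j) → IsMonicDeg (i +ᴺ j) (monic v *ₚ monic w)
    monic-*ₚ v w with withTop-*ₚ v 1# w 1#
    ... | u , e = u , ≋-trans e (withTop-cong ≈ᵥ-refl (*-identityˡ 1#))

    IsMonicDeg-*ₚ : ∀ {i j p q} → IsMonicDeg i p → IsMonicDeg j q → IsMonicDeg (i +ᴺ j) (p *ₚ q)
    IsMonicDeg-*ₚ (v , p≋v) (w , q≋w) with monic-*ₚ v w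
    ... | u , e = u , ≋-trans (*ₚ-cong p≋v q≋w) e

    module _ (0≉1 : ¬ (0# ≈ 1#)) where

      monic-degree : ∀ {i j} (v : Vec Carrier i) (w : Vec Carrier j) → monic v ≋ monic w → i ≡ j
      monic-degree [] [] _ = ≡.refl
      monic-degree [] (y ∷ w) (∷≋∷ _ e) = ⊥-elim (0≉1 (sym (withTop≋[] w (≋-sym e))))
      monic-degree (x ∷ v) [] (∷≋∷ _ e) = ⊥-elim (0≉1 (sym (withTop≋[] v e)))
      monic-degree (x ∷ v) (y ∷ w) (∷≋∷ _ e) = cong suc (monic-degree v w e)

      IsMonicDeg-unique : ∀ {i j p q} → IsMonicDeg i p → IsMonicDeg j q → p ≋ q → i ≡ j
      IsMonicDeg-unique (v , p≋v) (w , q≋w) p≋q = monic-degree v w (≋-trans (≋-sym p≋v) (≋-trans p≋q q≋w))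

module Coprimality where

  open import Level using (Level; _⊔_)
  open import Algebra.Bundles using (CommutativeRing)
  import Algebra.Properties.Ring as RingProps
  import Algebra.Properties.AbelianGroup as AbelianGroupProps
  open import Data.Nat using (suc)
  open import Data.List using ([]; _∷_; [_]; _∷ʳ_)
  open import Data.List.Reverse using (Reverse; reverseView; []; _∶_∶ʳ_)
  open import Data.Vec using (Vec; []; _∷_; fromList)
  open import Data.Vec.Properties using (toList∘fromList)
  open import Data.Product using (_,_)
  open import Data.Empty using (⊥-elim)
  import Relation.Binary.PropositionalEquality as ≡
  open ≡ using (_≡_)
  import Relation.Binary.Reasoning.Setoid as SetoidReasoning
  open import Relation.Nullary using (¬_)
  import Defs
  open Defs using ([]≋[]; ∷≋[]; ∷≋∷)
  open Polynomials using (module PolyRing)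
  open MonicPolynomials using (module Monic)

  module Coprime {c ℓ : Level} (R : CommutativeRing c ℓ) where
    open PolyRing R
    open Monic R

    infix 4 _∣ₚ_
    _∣ₚ_ : Poly → Poly → Set (c ⊔ ℓ)
    _∣ₚ_ = Defs._∣ₚ_ R

    Coprime : Poly → Poly → Set (c ⊔ ℓ)
    Coprime = Defs.Coprime R

    ∣-resp : ∀ d {p p′} → d ∣ₚ p → p ≋ p′ → d ∣ₚ p′
    ∣-resp d (e , de≋p) p≋p′ = e , ≋-trans de≋p p≋p′

    ∣-refl : ∀ p → p ∣ₚ p
    ∣-refl p = [ 1# ] , *ₚ-identityʳ p

    ∣-[] : ∀ p → p ∣ₚ []
    ∣-[] p = [] , *ₚ-zeroʳ p

    private
      *ₚ-swap : ∀ d M e → d *ₚ (M *ₚ e) ≋ M *ₚ (d *ₚ e)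
      *ₚ-swap d M e = ≋-trans (≋-sym (*ₚ-assoc d M e)) (≋-trans (*ₚ-congˡ (*ₚ-comm d M) e) (*ₚ-assoc M d e))

      ∣-*ₚ : ∀ d {p} M → d ∣ₚ p → d ∣ₚ M *ₚ p
      ∣-*ₚ d M (e , de≋p) = M *ₚ e , ≋-trans (*ₚ-swap d M e) (*ₚ-congʳ M de≋p)

      ∣-+ₚ : ∀ d {p q} → d ∣ₚ p → d ∣ₚ q → d ∣ₚ p +ₚ q
      ∣-+ₚ d (e , de≋p) (f , df≋q) = e +ₚ f , ≋-trans (*ₚ-distribˡ d e f) (+ₚ-cong de≋p df≋q)

      ∣-scale : ∀ d {p} a → d ∣ₚ p → d ∣ₚ scale a p
      ∣-scale d a (e , de≋p) = scale a e , ≋-trans (*ₚ-scaleʳ d a e) (scale-cong refl de≋p)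

      cancel : ∀ x y → (x + y) + - 1# * x ≈ y
      cancel x y = trans (+-congˡ (RingProps.-1*x≈-x ring x)) (AbelianGroupProps.xyx⁻¹≈y +-abelianGroup x y)

      ∣-remainder : ∀ d {b c r} M → d ∣ₚ b → d ∣ₚ c → b ≋ M *ₚ c +ₚ r → d ∣ₚ r
      ∣-remainder d {b} {c} {r} M d∣b d∣c b≋Mc+r =
        ∣-resp d (∣-+ₚ d d∣b (∣-scale d (- 1#) (∣-*ₚ d M d∣c))) (coeff⇒≋ λ i → begin
          coeff (b +ₚ scale (- 1#) (M *ₚ c)) i                ≈⟨ coeff-+ₚ b _ i ⟩
          coeff b i + coeff (scale (- 1#) (M *ₚ c)) i         ≈⟨ +-cong (≋⇒coeff b≋Mc+r i) (coeff-scale (- 1#) (M *ₚ c) i) ⟩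
          coeff (M *ₚ c +ₚ r) i + - 1# * coeff (M *ₚ c) i     ≈⟨ +-congʳ (coeff-+ₚ (M *ₚ c) r i) ⟩
          (coeff (M *ₚ c) i + coeff r i) + - 1# * coeff (M *ₚ c) i ≈⟨ cancel _ _ ⟩
          coeff r i                                           ∎)
        where open SetoidReasoning setoid

    coprime-sym : ∀ {b c} → Coprime b c → Coprime c b
    coprime-sym cop k v d∣c d∣b = cop k v d∣b d∣c

    coprime-resp : ∀ {b b′ c c′} → b ≋ b′ → c ≋ c′ → Coprime b c → Coprime b′ c′
    coprime-resp b≋b′ c≋c′ cop k v d∣b′ d∣c′ = cop k v (∣-resp (monic v) d∣b′ (≋-sym b≋b′)) (∣-resp (monic v) d∣c′ (≋-sym c≋c′))

    coprime-euclid⇒ : ∀ {b c r} M → b ≋ M *ₚ c +ₚ r → Coprime b c → Coprime c r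
    coprime-euclid⇒ M b≋Mc+r cop k v d∣c d∣r = cop k v (∣-resp (monic v) (∣-+ₚ (monic v) (∣-*ₚ (monic v) M d∣c) d∣r) (≋-sym b≋Mc+r)) d∣c

    coprime-euclid⇐ : ∀ {b c r} M → b ≋ M *ₚ c +ₚ r → Coprime c r → Coprime b c
    coprime-euclid⇐ M b≋Mc+r cop k v d∣b d∣c = cop k v d∣c (∣-remainder (monic v) M d∣b d∣c b≋Mc+r)

    coprime-scale⇒ : ∀ {c p} a → Coprime c (scale a p) → Coprime c p
    coprime-scale⇒ a cop k v d∣c d∣p = cop k v d∣c (∣-scale (monic v) a d∣p)

    coprime-scale⇐ : ∀ {c p a a′} → a′ * a ≈ 1# → Coprime c p → Coprime c (scale a p)
    coprime-scale⇐ {p = p} {a} {a′} a′a≈1 cop k v d∣c d∣ap = cop k v d∣c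
      (∣-resp (monic v) (∣-scale (monic v) a′ d∣ap) (≋-trans (scale-scale a′ a p) (≋-trans (scale-cong a′a≈1 ≋-refl) (scale-1 p))))

    coprime-[] : ∀ {k} (v : Vec Carrier k) → Coprime (monic v) [] → k ≡ 0
    coprime-[] v cop = cop _ v (∣-refl (monic v)) (∣-[] (monic v))

    module _ (0≉1 : ¬ (0# ≈ 1#)) where

      -- A monic polynomial of positive degree does not divide 1: writing the cofactor
      -- as e ∷ʳ t, the product has degree ≥ 1 with leading coefficient t, so t ≈ 0
      -- and the cofactor can be shortened.
      private
        monic⁺∤1 : ∀ {k} (v : Vec Carrier (suc k)) {e} → Reverse e → ¬ (monic v *ₚ e ≋ [ 1# ])
        monic⁺∤1 v [] ve≋1 = 0≉1 (≋⇒coeff (≋-trans (≋-sym (*ₚ-zeroʳ (monic v))) ve≋1) 0)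
        monic⁺∤1 {k} v (e ∶ rev-e ∶ʳ t) ve≋1 with withTop-*ₚ v 1# (fromList e) t
        ... | x ∷ u , vet≋u = monic⁺∤1 v rev-e (≋-trans (*ₚ-congʳ (monic v) (≋-sym e∷ʳt≋e)) ve≋1)
          where
          e∷ʳt≋withTop : e ∷ʳ t ≋ withTop (fromList e) t
          e∷ʳt≋withTop = ≡.subst (λ l → e ∷ʳ t ≋ l ∷ʳ t) (≡.sym (toList∘fromList e)) ≋-refl
          top≈0 : 1# * t ≈ 0#
          top≈0 with ≋-trans (≋-sym vet≋u) (≋-trans (≋-sym (*ₚ-congʳ (monic v) e∷ʳt≋withTop)) ve≋1)
          ... | ∷≋∷ _ u≋[] = withTop≋[] u u≋[]
          e∷ʳt≋e : e ∷ʳ t ≋ e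
          e∷ʳt≋e = drop-top e (trans (sym (*-identityˡ t)) top≈0)
            where
            drop-top : ∀ l {s} → s ≈ 0# → l ∷ʳ s ≋ l
            drop-top [] s≈0 = ∷≋[] s≈0 []≋[]
            drop-top (y ∷ l) s≈0 = ∷≋∷ refl (drop-top l s≈0)

      monic∣1⇒deg0 : ∀ {k} (v : Vec Carrier k) → monic v ∣ₚ [ 1# ] → k ≡ 0
      monic∣1⇒deg0 [] _ = ≡.refl
      monic∣1⇒deg0 (x ∷ v) (e , ve≋1) = ⊥-elim (monic⁺∤1 (x ∷ v) (reverseView e) ve≋1)

      coprime-1 : ∀ p → Coprime p [ 1# ]
      coprime-1 p k v _ d∣1 = monic∣1⇒deg0 v d∣1

module LongDivision where

  open import Level using (Level)
  open import Algebra.Bundles using (CommutativeRing)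
  open import Data.Nat using (zero; suc) renaming (_+_ to _+ᴺ_)
  open import Data.List using ([]; _∷_)
  open import Data.Vec using (Vec; []; _∷_; toList; last)
  open import Data.Vec.Relation.Binary.Pointwise.Inductive using ([]; _∷_)
  open import Data.Product using (_×_; _,_; proj₁; proj₂)
  import Relation.Binary.Reasoning.Setoid as SetoidReasoning
  open import Defs using ([]≋[]; ∷≋∷)
  open Polynomials using (module PolyRing)
  open MonicPolynomials using (module Monic)

  module Division {c ℓ : Level} (R : CommutativeRing c ℓ) where
    open PolyRing R
    open Monic R

    private
      +-minus : ∀ x z → x + (z + - x) ≈ z
      +-minus x z = trans (+-comm x _) (trans (+-assoc z (- x) x) (trans (+-congˡ (-‿inverseˡ x)) (+-identityʳ z)))

      last-cong : ∀ {k} {z z′ : Vec Carrier (suc k)} → z ≈ᵥ z′ → last z ≈ last z′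
      last-cong (z≈z′ ∷ []) = z≈z′
      last-cong (_ ∷ zs≈zs′@(_ ∷ _)) = last-cong zs≈zs′

    -- Subtract α·c from the k+1 coefficients z; when α is the leading entry of z,
    -- the top coefficient cancels and k coefficients remain.
    reduce : ∀ {k} → Vec Carrier (suc k) → Vec Carrier k → Carrier → Vec Carrier k
    reduce {zero} (z ∷ []) [] α = []
    reduce {suc k} (z ∷ zs) (c ∷ cs) α = (z + - (α * c)) ∷ reduce zs cs α

    reduce-spec : ∀ {k} (z : Vec Carrier (suc k)) (c : Vec Carrier k) α → α ≈ last z →
      toList z ≋ scale α (monic c) +ₚ toList (reduce z c α)
    reduce-spec {zero} (z ∷ []) [] α α≈z = ∷≋∷ (trans (sym α≈z) (sym (*-identityʳ α))) []≋[]
    reduce-spec {suc k} (z ∷ zs) (c ∷ cs) α α≈last =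
      ∷≋∷ (sym (+-minus (α * c) z)) (reduce-spec zs cs α α≈last)

    reduce-cong : ∀ {k} {z z′ : Vec Carrier (suc k)} {c c′ : Vec Carrier k} {α α′} →
      z ≈ᵥ z′ → c ≈ᵥ c′ → α ≈ α′ → reduce z c α ≈ᵥ reduce z′ c′ α′
    reduce-cong {zero} (_ ∷ []) [] _ = []
    reduce-cong {suc k} (z≈z′ ∷ zs≈zs′) (c≈c′ ∷ cs≈cs′) α≈α′ =
      +-cong z≈z′ (-‿cong (*-cong α≈α′ c≈c′)) ∷ reduce-cong zs≈zs′ cs≈cs′ α≈α′

    private
      _∸ᵥ_ : ∀ {k} → Vec Carrier k → Vec Carrier k → Vec Carrier k
      [] ∸ᵥ [] = []
      (x ∷ b) ∸ᵥ (y ∷ c) = (x + - y) ∷ (b ∸ᵥ c)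

      ∸ᵥ-spec : ∀ {k} (b c : Vec Carrier k) → monic b ≋ monic c +ₚ toList (b ∸ᵥ c)
      ∸ᵥ-spec [] [] = ≋-refl
      ∸ᵥ-spec (x ∷ b) (y ∷ c) = ∷≋∷ (sym (+-minus y x)) (∸ᵥ-spec b c)

      ∸ᵥ-cong : ∀ {k} {b b′ c c′ : Vec Carrier k} → b ≈ᵥ b′ → c ≈ᵥ c′ → (b ∸ᵥ c) ≈ᵥ (b′ ∸ᵥ c′)
      ∸ᵥ-cong [] [] = []
      ∸ᵥ-cong (x≈x′ ∷ b≈b′) (y≈y′ ∷ c≈c′) = +-cong x≈x′ (-‿cong y≈y′) ∷ ∸ᵥ-cong b≈b′ c≈c′

    divide : ∀ d {k} → Vec Carrier (d +ᴺ k) → Vec Carrier k → Vec Carrier d × Vec Carrier k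
    divide zero b c = [] , (b ∸ᵥ c)
    divide (suc d) (b₀ ∷ b) c = last z ∷ proj₁ (divide d b c) , reduce z c (last z)
      where z = b₀ ∷ proj₂ (divide d b c)

    quotient : ∀ d {k} → Vec Carrier (d +ᴺ k) → Vec Carrier k → Vec Carrier d
    quotient d b c = proj₁ (divide d b c)

    remainder : ∀ d {k} → Vec Carrier (d +ᴺ k) → Vec Carrier k → Vec Carrier k
    remainder d b c = proj₂ (divide d b c)

    divide-spec : ∀ d {k} (b : Vec Carrier (d +ᴺ k)) (c : Vec Carrier k) →
      monic b ≋ monic (quotient d b c) *ₚ monic c +ₚ toList (remainder d b c)
    divide-spec zero b c = ≋-trans (∸ᵥ-spec b c) (+ₚ-cong (≋-sym (*ₚ-identityˡ (monic c))) ≋-refl)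
    divide-spec (suc d) (b₀ ∷ b) c = begin
      b₀ ∷ monic b                                ≈⟨ ∷≋∷ (sym (+-identityˡ b₀)) (divide-spec d b c) ⟩
      shift (Qc) +ₚ (b₀ ∷ toList r)               ≈⟨ +ₚ-cong (≋-refl {shift Qc}) (reduce-spec z c α refl) ⟩
      shift (Qc) +ₚ (scale α mc +ₚ toList r′)     ≈⟨ +ₚ-assoc (shift Qc) (scale α mc) _ ⟨
      shift (Qc) +ₚ scale α mc +ₚ toList r′       ≈⟨ +ₚ-cong (+ₚ-comm (shift Qc) (scale α mc)) ≋-refl ⟩
      scale α mc +ₚ shift (Qc) +ₚ toList r′       ∎
      where
      open SetoidReasoning ≋-setoid
      mc = monic c
      r = remainder d b c
      Qc = monic (quotient d b c) *ₚ mc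
      z = b₀ ∷ r
      α = last z
      r′ = reduce z c α

    divide-cong : ∀ d {k} {b b′ : Vec Carrier (d +ᴺ k)} {c c′ : Vec Carrier k} → b ≈ᵥ b′ → c ≈ᵥ c′ →
      quotient d b c ≈ᵥ quotient d b′ c′ × remainder d b c ≈ᵥ remainder d b′ c′
    divide-cong zero b≈b′ c≈c′ = [] , ∸ᵥ-cong b≈b′ c≈c′
    divide-cong (suc d) (b₀≈b₀′ ∷ b≈b′) c≈c′ with divide-cong d b≈b′ c≈c′
    ... | Q≈Q′ , r≈r′ = α≈α′ ∷ Q≈Q′ , reduce-cong z≈z′ c≈c′ α≈α′
      where
      z≈z′ = b₀≈b₀′ ∷ r≈r′
      α≈α′ = last-cong z≈z′

module Counts where

  open import Data.Nat using (ℕ; zero; suc; _+_; _*_; _∸_; _^_; _≤_; _<_; s≤s)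
  open import Data.Nat.Properties
    using (*-comm; *-identityʳ; +-identityʳ; +-suc; +-comm; ^-distribˡ-+-*; m+[n∸m]≡n; m∸n+n≡m; m+n∸m≡n; n∸n≡0; m≤m+n; ≤-pred; <⇒≤)
  open import Data.Nat.Combinatorics using (_C_; nC1≡n; nCk+nC[k+1]≡[n+1]C[k+1])
  open import Data.Nat.Solver using (module +-*-Solver)
  open import Data.Product using (_×_; _,_)
  open import Relation.Binary.PropositionalEquality using (_≡_; refl; sym; trans; cong; cong₂; subst; module ≡-Reasoning)
  open Sums using (∑<; ∑<-cong; ∑<-suc; ∑<-+; ∑<-*ˡ; ∑<-const)
  open +-*-Solver

  module Arithmetic (u : ℕ) where

    q : ℕ
    q = suc u

    -- The number of coprime pairs of monic polynomials of degrees j and k.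
    coprimeCount : ℕ → ℕ → ℕ
    coprimeCount j zero = q ^ j
    coprimeCount zero (suc k) = q ^ suc k
    coprimeCount (suc j) (suc k) = u * q ^ (j + suc k)

    -- The number of pairs (c, r), c monic of degree k and r a polynomial with
    -- n coefficients, that are coprime: split on whether the top coefficient of r is zero.
    remainderCount : ℕ → ℕ → ℕ
    remainderCount k (suc n) = remainderCount k n + coprimeCount k n * u
    remainderCount zero zero = 1
    remainderCount (suc k) zero = 0

    coprimeCount-sym : ∀ j k → coprimeCount j k ≡ coprimeCount k j
    coprimeCount-sym zero zero = refl
    coprimeCount-sym (suc j) zero = refl
    coprimeCount-sym zero (suc k) = refl
    coprimeCount-sym (suc j) (suc k) = cong (λ e → u * q ^ e) (trans (+-suc j k) (trans (cong suc (+-comm j k)) (sym (+-suc k j))))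

    remainderCount-closed : ∀ k n → remainderCount (suc k) (suc n) ≡ u * q ^ (suc k + n)
    remainderCount-closed k zero = trans (*-comm (q ^ suc k) u) (cong (λ e → u * q ^ e) (sym (+-identityʳ (suc k))))
    remainderCount-closed k (suc n) = begin
      remainderCount (suc k) (suc n) + u * q ^ (k + suc n) * u  ≡⟨ cong₂ (λ a e → a + u * q ^ e * u) (remainderCount-closed k n) (+-suc k n) ⟩
      u * X + u * X * u                                         ≡⟨ solve 2 (λ u x → u :* x :+ u :* x :* u := u :* ((con 1 :+ u) :* x)) refl u X ⟩
      u * (q * X)                                               ≡⟨ cong (λ e → u * q ^ e) (sym (+-suc (suc k) n)) ⟩
      u * q ^ (suc k + suc n)                                   ∎
      where
      open ≡-Reasoning
      X = q ^ (suc k + n)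

    -- Division by a monic of degree k multiplies by the q^d choices of quotient.
    divisionCount : ∀ d k → q ^ d * remainderCount k k ≡ coprimeCount (d + k) k
    divisionCount d zero = trans (*-identityʳ (q ^ d)) (cong (q ^_) (sym (+-identityʳ d)))
    divisionCount d (suc k) = begin
      q ^ d * remainderCount (suc k) (suc k)   ≡⟨ cong (q ^ d *_) (remainderCount-closed k k) ⟩
      q ^ d * (u * q ^ (suc k + k))            ≡⟨ solve 3 (λ a u b → a :* (u :* b) := u :* (a :* b)) refl (q ^ d) u (q ^ (suc k + k)) ⟩
      u * (q ^ d * q ^ (suc k + k))            ≡⟨ cong (u *_) (sym (^-distribˡ-+-* q d (suc k + k))) ⟩
      u * q ^ (d + (suc k + k))                ≡⟨ cong (λ e → u * q ^ e) (solve 2 (λ d k → d :+ (con 1 :+ k :+ k) := (d :+ k) :+ (con 1 :+ k)) refl d k) ⟩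
      u * q ^ ((d + k) + suc k)                ≡⟨ cong (λ e → coprimeCount e (suc k)) (sym (+-suc d k)) ⟩
      coprimeCount (d + suc k) (suc k)         ∎
      where open ≡-Reasoning

    -- Pairs of monic polynomials with degrees summing to t.
    monicPairs : ℕ → ℕ
    monicPairs t = ∑< (λ i → q ^ i * q ^ (t ∸ i)) (suc t)

    -- Coprime pairs of monic polynomials with degrees summing to s.
    coprimePairs : ℕ → ℕ
    coprimePairs s = ∑< (λ j → coprimeCount j (s ∸ j)) (suc s)

    -- |𝓢_m|: the degrees of b·c and a·d add up to m.
    total : ℕ → ℕ
    total m = ∑< (λ s → monicPairs (m ∸ s) * coprimePairs s) (suc m)

    private
      ∸-suc : ∀ j s → j < s → s ∸ j ≡ suc (s ∸ suc j)
      ∸-suc zero (suc s) _ = refl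
      ∸-suc (suc j) (suc s) (s≤s j<s) = ∸-suc j s j<s

    monicPairs-closed : ∀ t → monicPairs t ≡ suc t * q ^ t
    monicPairs-closed t = trans (∑<-cong _ (λ _ → q ^ t) (suc t) same) (∑<-const (q ^ t) (suc t))
      where
      same : ∀ i → i < suc t → q ^ i * q ^ (t ∸ i) ≡ q ^ t
      same i i<1+t = trans (sym (^-distribˡ-+-* q i (t ∸ i))) (cong (q ^_) (m+[n∸m]≡n (≤-pred i<1+t)))

    coprimePairs-closed : ∀ s → coprimePairs (suc s) ≡ 2 * q ^ suc s + s * (u * q ^ s)
    coprimePairs-closed s = trans (cong₂ _+_ (∑<-suc f s) last)
      (trans (cong (λ m → (q ^ suc s + m) + q ^ suc s) middle)
        (solve 3 (λ a s b → (a :+ s :* b) :+ a := con 2 :* a :+ s :* b) refl (q ^ suc s) s (u * q ^ s)))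
      where
      f : ℕ → ℕ
      f j = coprimeCount j (suc s ∸ j)
      last : f (suc s) ≡ q ^ suc s
      last = cong (coprimeCount (suc s)) (n∸n≡0 s)
      middle : ∑< (λ t → f (suc t)) s ≡ s * (u * q ^ s)
      middle = trans (∑<-cong _ (λ _ → u * q ^ s) s term) (∑<-const _ s)
        where
        term : ∀ j → j < s → f (suc j) ≡ u * q ^ s
        term j j<s = trans (cong (coprimeCount (suc j)) (∸-suc j s j<s))
          (cong (λ e → u * q ^ e) (trans (cong (j +_) (sym (∸-suc j s j<s))) (m+[n∸m]≡n (<⇒≤ j<s))))

    private
      h : ℕ → ℕ
      h s = 2 * q + s * u

      ∑h-closed : ∀ n → ∑< h (suc n) ≡ 2 * q * suc n + u * (suc n C 2)
      ∑h-closed zero = solve 2 (λ q u → con 0 :+ (con 2 :* q :+ con 0 :* u) := con 2 :* q :* con 1 :+ u :* con 0) refl q u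
      ∑h-closed (suc n) = trans (cong (_+ h (suc n)) (∑h-closed n))
        (trans (solve 4 (λ q u n c → (con 2 :* q :* (con 1 :+ n) :+ u :* c) :+ (con 2 :* q :+ (con 1 :+ n) :* u)
                                     := con 2 :* q :* (con 2 :+ n) :+ u :* ((con 1 :+ n) :+ c)) refl q u n (suc n C 2))
          (cong (λ c → 2 * q * suc (suc n) + u * c)
            (trans (cong (_+ (suc n C 2)) (sym (nC1≡n (suc n)))) (nCk+nC[k+1]≡[n+1]C[k+1] (suc n) 1))))

      weighted : ℕ → ℕ
      weighted n = ∑< (λ s → suc (n ∸ s) * h s) (suc n)

      weighted-suc : ∀ n → weighted (suc n) ≡ weighted n + ∑< h (suc (suc n))
      weighted-suc n = trans (cong₂ _+_ lower top)
        (solve 3 (λ a b c → (a :+ b) :+ c := b :+ (a :+ c)) refl (∑< h (suc n)) (weighted n) (h (suc n)))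
        where
        top : suc (suc n ∸ suc n) * h (suc n) ≡ h (suc n)
        top = trans (cong (λ z → suc z * h (suc n)) (n∸n≡0 n)) (+-identityʳ (h (suc n)))
        lower : ∑< (λ s → suc (suc n ∸ s) * h s) (suc n) ≡ ∑< h (suc n) + weighted n
        lower = trans (∑<-cong _ (λ s → h s + suc (n ∸ s) * h s) (suc n)
                         (λ s s<1+n → cong (λ z → suc z * h s) (∸-suc s (suc n) s<1+n)))
                      (∑<-+ h (λ s → suc (n ∸ s) * h s) (suc n))

      weighted-closed : ∀ n → weighted n ≡ q * (suc n * suc (suc n)) + u * (suc (suc n) C 3)
      weighted-closed zero = solve 2 (λ q u → con 0 :+ (con 1 :+ con 0) :* (con 2 :* q :+ con 0 :* u) := q :* (con 1 :* con 2) :+ u :* con 0) refl q u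
      weighted-closed (suc n) = trans (weighted-suc n) (trans (cong₂ _+_ (weighted-closed n) (∑h-closed (suc n)))
        (trans (solve 5 (λ q u n c3 c2 → (q :* ((con 1 :+ n) :* (con 2 :+ n)) :+ u :* c3) :+ (con 2 :* q :* (con 2 :+ n) :+ u :* c2)
                                         := q :* ((con 2 :+ n) :* (con 3 :+ n)) :+ u :* (c2 :+ c3))
                       refl q u n (suc (suc n) C 3) (suc (suc n) C 2))
          (cong (λ c → q * (suc (suc n) * suc (suc (suc n))) + u * c) (nCk+nC[k+1]≡[n+1]C[k+1] (suc (suc n)) 2))))

    -- Splitting off s = 0, every other term is q^m (m+1-s)·h(s).
    total-closed : ∀ m → total (suc m) ≡ q ^ m * u * (suc (suc m) C 3) + q ^ suc m * (suc (suc m) * suc (suc m))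
    total-closed m = trans (∑<-suc (λ s → monicPairs (suc m ∸ s) * coprimePairs s) (suc m))
      (trans (cong₂ _+_ (cong (_* 1) (monicPairs-closed (suc m))) rest)
        (trans (cong (λ w → suc (suc m) * q ^ suc m * 1 + q ^ m * w) (weighted-closed m))
          (solve 5 (λ n Z q u c → (con 2 :+ n) :* (q :* Z) :* con 1 :+ Z :* (q :* ((con 1 :+ n) :* (con 2 :+ n)) :+ u :* c)
                                 := Z :* u :* c :+ q :* Z :* ((con 2 :+ n) :* (con 2 :+ n)))
                 refl m (q ^ m) q u (suc (suc m) C 3))))
      where
      rest : ∑< (λ s → monicPairs (m ∸ s) * coprimePairs (suc s)) (suc m) ≡ q ^ m * weighted m
      rest = trans (∑<-cong _ (λ s → q ^ m * (suc (m ∸ s) * h s)) (suc m) term)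
                   (∑<-*ˡ (q ^ m) (λ s → suc (m ∸ s) * h s) (suc m))
        where
        term : ∀ s → s < suc m → monicPairs (m ∸ s) * coprimePairs (suc s) ≡ q ^ m * (suc (m ∸ s) * h s)
        term s s<1+m = trans (cong₂ _*_ (monicPairs-closed (m ∸ s)) (coprimePairs-closed s))
          (trans (solve 6 (λ c X Y q s u → (c :* X) :* (con 2 :* (q :* Y) :+ s :* (u :* Y)) := (X :* Y) :* (c :* (con 2 :* q :+ s :* u)))
                          refl (suc (m ∸ s)) (q ^ (m ∸ s)) (q ^ s) q s u)
            (cong (λ z → z * (suc (m ∸ s) * h s))
              (trans (sym (^-distribˡ-+-* q (m ∸ s) s)) (cong (q ^_) (m∸n+n≡m (≤-pred s<1+m))))))

  degrees-split : ∀ {ka kb kc kd m} → ka + kb + kc + kd ≡ m →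
    kb + kc ≤ m × ka ≤ m ∸ (kb + kc) × (m ∸ (kb + kc)) ∸ ka ≡ kd
  degrees-split {ka} {kb} {kc} {kd} refl =
    subst (kb + kc ≤_) (sym regroup) (m≤m+n (kb + kc) (ka + kd)) ,
    subst (ka ≤_) (sym rest) (m≤m+n ka kd) ,
    trans (cong (_∸ ka) rest) (m+n∸m≡n ka kd)
    where
    regroup : ka + kb + kc + kd ≡ (kb + kc) + (ka + kd)
    regroup = solve 4 (λ a b c d → a :+ b :+ c :+ d := (b :+ c) :+ (a :+ d)) refl ka kb kc kd
    rest : ka + kb + kc + kd ∸ (kb + kc) ≡ ka + kd
    rest = trans (cong (_∸ (kb + kc)) regroup) (m+n∸m≡n (kb + kc) (ka + kd))

  degrees-join : ∀ {i j s m} → j ≤ s → s ≤ m → i ≤ m ∸ s → i + j + (s ∸ j) + ((m ∸ s) ∸ i) ≡ m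
  degrees-join {i} {j} {s} {m} j≤s s≤m i≤m∸s = trans
    (solve 4 (λ i j a b → i :+ j :+ a :+ b := (j :+ a) :+ (i :+ b)) refl i j (s ∸ j) ((m ∸ s) ∸ i))
    (trans (cong₂ _+_ (m+[n∸m]≡n j≤s) (m+[n∸m]≡n i≤m∸s)) (m+[n∸m]≡n s≤m))

module CoprimePairs where

  open import Level using (Level; _⊔_)
  open import Algebra.Bundles using (CommutativeRing)
  open import Data.Nat using (ℕ; zero; suc; _≤_; _<_; _≤?_; _∸_; _^_) renaming (_+_ to _+ᴺ_; _*_ to _*ᴺ_)
  open import Data.Nat.Properties using (≤-refl; ≰⇒>; m∸n+n≡m; m<n⇒m<1+n; ^-distribˡ-+-*) renaming (*-assoc to *ᴺ-assoc)
  open import Data.Nat.Induction using (<-rec)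
  open import Data.List using ([])
  open import Data.Vec as Vec using (Vec; []; _∷_; toList; _∷ʳ_; initLast)
  open import Data.Vec.Properties using (toList-∷ʳ)
  open import Data.Vec.Relation.Binary.Pointwise.Inductive as Pw using ([]; _∷_)
  open import Data.Product using (Σ; _×_; _,_; proj₁; proj₂)
  open import Data.Product.Relation.Binary.Pointwise.NonDependent using (_×ₛ_; ×-decidable)
  open import Data.Sum using (_⊎_; inj₁; inj₂)
  open import Data.Unit.Polymorphic using (⊤)
  open import Relation.Binary.Bundles using (Setoid)
  open import Relation.Binary.Definitions using (Decidable)
  import Relation.Binary.PropositionalEquality as ≡
  open ≡ using (_≡_)
  open import Relation.Nullary using (¬_; yes; no; ¬?)
  open import Relation.Unary using (U)
  open import Defs using (HasCard; IsField; HasSize)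
  open FiniteCounting using (module OneSetoid; module TwoSetoids)
  open Polynomials using (module PolyRing)
  open MonicPolynomials using (module Monic)
  open Coprimality using (module Coprime)
  open LongDivision using (module Division)
  open Counts using (module Arithmetic)

  module FiniteRing {a ℓ : Level} (F : CommutativeRing a ℓ) where
    open CommutativeRing F
    open OneSetoid setoid

    NonZero : Carrier → Set ℓ
    NonZero x = ¬ (x ≈ 0#)

    nonzero-count : ∀ {q} → HasSize F q → Σ ℕ λ u → q ≡ suc u × HasCard _≈_ NonZero u
    nonzero-count size with card-filter (λ x → ¬? (finite⇒decidable size x 0#)) (λ x≈y x≉0 y≈0 → x≉0 (trans x≈y y≈0)) size
    ... | u , filtered = u , card-unique size everything , nonzero
      where
      nonzero : HasCard _≈_ NonZero u
      nonzero = card-⇔ (λ _ → proj₂) (λ _ x≉0 → _ , x≉0) filtered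
      zero-or-not : ∀ x → (x ≈ 0#) ⊎ NonZero x
      zero-or-not x with finite⇒decidable size x 0#
      ... | yes x≈0 = inj₁ x≈0
      ... | no x≉0 = inj₂ x≉0
      everything : HasCard _≈_ (λ _ → ⊤ {ℓ = ℓ}) (suc u)
      everything = card-⇔ (λ _ _ → _) (λ x _ → zero-or-not x)
        (card-⊎ (λ x y x≈0 y≉0 x≈y → y≉0 (trans (sym x≈y) x≈0)) (card-single 0# refl (λ _ x≈0 → x≈0)) nonzero)

  module CoprimeCount {a ℓ : Level} (F : CommutativeRing a ℓ) (isField : IsField F) (u : ℕ)
    (size : HasSize F (suc u)) (units : HasCard (CommutativeRing._≈_ F) (FiniteRing.NonZero F) u) where
    open PolyRing F
    open Monic F
    open Coprime F
    open Division F
    open Arithmetic u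
    open FiniteRing F using (NonZero)

    private
      0≉1 : ¬ (0# ≈ 1#)
      0≉1 = proj₁ isField

      inverse : ∀ x → NonZero x → Σ Carrier λ y → x * y ≈ 1#
      inverse = proj₂ isField

    _≟_ : Decidable _≈_
    _≟_ = OneSetoid.finite⇒decidable setoid size

    Vecs : ℕ → Setoid a (a ⊔ ℓ)
    Vecs = ≈ᵥ-setoid

    Pairs : ℕ → ℕ → Setoid a (a ⊔ ℓ)
    Pairs j k = Vecs j ×ₛ Vecs k

    vectors : ∀ n → HasCard _≈ᵥ_ U (q ^ n)
    vectors zero = OneSetoid.card-single (Vecs 0) [] _ (λ { [] _ → [] })
    vectors (suc n) = TwoSetoids.card-image (setoid ×ₛ Vecs n) (Vecs (suc n))
      (λ (x , v) → x ∷ v) (λ (x≈y , v≈w) → x≈y ∷ v≈w) (λ { _ _ _ _ (x≈y ∷ v≈w) → x≈y , v≈w })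
      (λ _ _ → _) (λ { (x ∷ v) _ → (x , v) , _ , ≈ᵥ-refl })
      (TwoSetoids.card-× setoid (Vecs n) size (vectors n))

    CoprimeMonics : ∀ {j k} → Vec Carrier j × Vec Carrier k → Set (a ⊔ ℓ)
    CoprimeMonics (b , e) = Coprime (monic b) (monic e)

    CoprimeRemainder : ∀ {k n} → Vec Carrier k × Vec Carrier n → Set (a ⊔ ℓ)
    CoprimeRemainder (e , r) = Coprime (monic e) (toList r)

    remainders₀ : ∀ k → HasCard (Setoid._≈_ (Pairs k 0)) CoprimeRemainder (remainderCount k 0)
    remainders₀ zero = OneSetoid.card-single (Pairs 0 0) ([] , []) (coprime-sym (coprime-1 0≉1 [])) (λ { ([] , []) _ → [] , [] })
    remainders₀ (suc k) = OneSetoid.card-∅ (Pairs (suc k) 0) (λ { (e , []) cop → 1+k≢0 (coprime-[] e cop) })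
      where
      1+k≢0 : ¬ (suc k ≡ 0)
      1+k≢0 ()

    -- Remainders with n + 1 coefficients, written as (e, w, t) with r = w ∷ʳ t.
    Split : ℕ → ℕ → Setoid a (a ⊔ ℓ)
    Split k n = Vecs k ×ₛ (Vecs n ×ₛ setoid)

    CoprimeTop : ∀ {k n} → Vec Carrier k × (Vec Carrier n × Carrier) → Set (a ⊔ ℓ)
    CoprimeTop (e , w , t) = Coprime (monic e) (withTop w t)

    Top : ∀ {k n} → (Carrier → Set ℓ) → Vec Carrier k × (Vec Carrier n × Carrier) → Set (a ⊔ ℓ)
    Top P x = CoprimeTop x × P (proj₂ (proj₂ x))

    top-zero : ∀ {k n N} → HasCard (Setoid._≈_ (Pairs k n)) CoprimeRemainder N →
      HasCard (Setoid._≈_ (Split k n)) (Top (_≈ 0#)) N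
    top-zero = TwoSetoids.card-image (Pairs _ _) (Split _ _) (λ (e , w) → e , w , 0#)
      (λ (e≈ , w≈) → e≈ , w≈ , refl) (λ _ _ _ _ (e≈ , w≈ , _) → e≈ , w≈)
      (λ (e , w) cop → coprime-resp ≋-refl (≋-sym (drop-zero w refl)) cop , refl)
      (λ { (e , w , t) (cop , t≈0) → (e , w) , coprime-resp ≋-refl (drop-zero w t≈0) cop , ≈ᵥ-refl , ≈ᵥ-refl , sym t≈0 })
      where
      drop-zero : ∀ {n} (w : Vec Carrier n) {t} → t ≈ 0# → withTop w t ≋ toList w
      drop-zero [] t≈0 = Defs.∷≋[] t≈0 Defs.[]≋[]
      drop-zero (x ∷ w) t≈0 = Defs.∷≋∷ refl (drop-zero w t≈0)

    -- With a unit t on top, w ∷ʳ t = t · monic(t⁻¹ w): one coprime monic pair per unit.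
    top-unit : ∀ {k n N} → HasCard (Setoid._≈_ (Pairs k n)) CoprimeMonics N →
      HasCard (Setoid._≈_ (Split k n)) (Top NonZero) (N *ᴺ u)
    top-unit {k} {n} coprimes = TwoSetoids.card-image (Pairs k n ×ₛ setoid) (Split k n) scaleTop
      (λ ((e≈ , w≈) , t≈) → e≈ , scaleᵥ-cong t≈ w≈ , t≈) injective
      (λ ((e , w) , t) (cop , t≉0) →
        coprime-resp ≋-refl (scale-monic t w) (coprime-scale⇐ (left-inverse t≉0) cop) , t≉0)
      onto (TwoSetoids.card-× (Pairs k n) setoid coprimes units)
      where
      scaleTop : (Vec Carrier k × Vec Carrier n) × Carrier → Vec Carrier k × (Vec Carrier n × Carrier)
      scaleTop ((e , w) , t) = e , scaleᵥ t w , t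
      CoprimeUnit : (Vec Carrier k × Vec Carrier n) × Carrier → Set (a ⊔ ℓ)
      CoprimeUnit x = CoprimeMonics (proj₁ x) × NonZero (proj₂ x)
      left-inverse : ∀ {t} (t≉0 : NonZero t) → proj₁ (inverse t t≉0) * t ≈ 1#
      left-inverse {t} t≉0 = trans (*-comm _ t) (proj₂ (inverse t t≉0))
      injective : TwoSetoids.InjectiveOn (Pairs k n ×ₛ setoid) (Split k n) CoprimeUnit scaleTop
      injective ((e , w) , t) ((e′ , w′) , t′) (_ , t≉0) (_ , t′≉0) (e≈ , tw≈t′w′ , t≈) =
        (e≈ , Pw.trans trans (Pw.sym sym (scaleᵥ-inverse w (left-inverse t≉0)))
                  (Pw.trans trans (scaleᵥ-cong (refl {proj₁ (inverse t t≉0)}) tw≈t′w′)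
                                   (scaleᵥ-inverse w′ (trans (*-congˡ (sym t≈)) (left-inverse t≉0))))) , t≈
      onto : TwoSetoids.OntoOn (Pairs k n ×ₛ setoid) (Split k n) CoprimeUnit (Top NonZero) scaleTop
      onto (e , w , t) (cop , t≉0) =
        ((e , scaleᵥ t⁻¹ w) , t) ,
        (coprime-scale⇒ t (coprime-resp ≋-refl (≋-trans (withTop-cong (Pw.sym sym unscaled) refl) (≋-sym (scale-monic t _))) cop) , t≉0) ,
        ≈ᵥ-refl , unscaled , refl
        where
        t⁻¹ : Carrier
        t⁻¹ = proj₁ (inverse t t≉0)
        unscaled : scaleᵥ t (scaleᵥ t⁻¹ w) ≈ᵥ w
        unscaled = scaleᵥ-inverse w (proj₂ (inverse t t≉0))

    split-top : ∀ {k n N} → HasCard (Setoid._≈_ (Split k n)) CoprimeTop N →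
      HasCard (Setoid._≈_ (Pairs k (suc n))) CoprimeRemainder N
    split-top {k} {n} = TwoSetoids.card-image (Split k n) (Pairs k (suc n)) glue
      (λ (e≈ , w≈ , t≈) → e≈ , ∷ʳ-cong w≈ t≈) injective
      (λ (e , w , t) cop → ≡.subst (Coprime (monic e)) (≡.sym (toList-∷ʳ t w)) cop)
      onto
      where
      glue : Vec Carrier k × (Vec Carrier n × Carrier) → Vec Carrier k × Vec Carrier (suc n)
      glue (e , w , t) = e , w ∷ʳ t
      injective : TwoSetoids.InjectiveOn (Split k n) (Pairs k (suc n)) CoprimeTop glue
      injective (e , w , t) (e′ , w′ , t′) _ _ (e≈ , r≈) =
        e≈ , withTop-injective w w′ (≡.subst₂ _≋_ (toList-∷ʳ t w) (toList-∷ʳ t′ w′) (toList-cong r≈))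
      onto : TwoSetoids.OntoOn (Split k n) (Pairs k (suc n)) CoprimeTop CoprimeRemainder glue
      onto (e , r) cop with initLast r
      ... | w , t , ≡.refl = (e , w , t) , ≡.subst (Coprime (monic e)) (toList-∷ʳ t w) cop , ≈ᵥ-refl , ≈ᵥ-refl

    remainders-step : ∀ {k n N₁ N₂} → HasCard (Setoid._≈_ (Pairs k n)) CoprimeRemainder N₁ →
      HasCard (Setoid._≈_ (Pairs k n)) CoprimeMonics N₂ →
      HasCard (Setoid._≈_ (Pairs k (suc n))) CoprimeRemainder (N₁ +ᴺ N₂ *ᴺ u)
    remainders-step remainders coprimes = split-top (OneSetoid.card-⇔ (Split _ _) merge split
      (OneSetoid.card-⊎ (Split _ _) apart (top-zero remainders) (top-unit coprimes)))
      where
      merge : ∀ x → Top (_≈ 0#) x ⊎ Top NonZero x → CoprimeTop x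
      merge _ (inj₁ (cop , _)) = cop
      merge _ (inj₂ (cop , _)) = cop
      split : ∀ x → CoprimeTop x → Top (_≈ 0#) x ⊎ Top NonZero x
      split (e , w , t) cop with t ≟ 0#
      ... | yes t≈0 = inj₁ (cop , t≈0)
      ... | no t≉0 = inj₂ (cop , t≉0)
      apart : ∀ x y → Top (_≈ 0#) x → Top NonZero y → ¬ Setoid._≈_ (Split _ _) x y
      apart _ _ (_ , t≈0) (_ , t′≉0) (_ , _ , t≈t′) = t′≉0 (trans (sym t≈t′) t≈0)

    remainders : ∀ k n → (∀ {m} → m < n → HasCard (Setoid._≈_ (Pairs k m)) CoprimeMonics (coprimeCount k m)) →
      HasCard (Setoid._≈_ (Pairs k n)) CoprimeRemainder (remainderCount k n)
    remainders k zero _ = remainders₀ k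
    remainders k (suc n) coprimes = remainders-step (remainders k n (λ m<n → coprimes (m<n⇒m<1+n m<n))) (coprimes ≤-refl)

    module Euclid (d k : ℕ) where

      Triples : Setoid a (a ⊔ ℓ)
      Triples = Vecs d ×ₛ Pairs k k

      euclid : Vec Carrier (d +ᴺ k) × Vec Carrier k → Vec Carrier d × (Vec Carrier k × Vec Carrier k)
      euclid (b , e) = quotient d b e , e , remainder d b e

      euclid-cong : TwoSetoids.Congruent (Pairs (d +ᴺ k) k) Triples euclid
      euclid-cong (b≈b′ , e≈e′) with divide-cong d b≈b′ e≈e′
      ... | Q≈Q′ , r≈r′ = Q≈Q′ , e≈e′ , r≈r′

      -- b is recovered as Q·e + r.
      euclid-injective : ∀ x y → Setoid._≈_ Triples (euclid x) (euclid y) → Setoid._≈_ (Pairs (d +ᴺ k) k) x y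
      euclid-injective (b , e) (b′ , e′) (Q≈Q′ , e≈e′ , r≈r′) =
        monic-injective b b′ (≋-trans (divide-spec d b e) (≋-trans
          (+ₚ-cong (*ₚ-cong (monic-cong Q≈Q′) (monic-cong e≈e′)) (toList-cong r≈r′))
          (≋-sym (divide-spec d b′ e′)))) , e≈e′

      private
        same-size : q ^ (d +ᴺ k) *ᴺ q ^ k ≡ q ^ d *ᴺ (q ^ k *ᴺ q ^ k)
        same-size = ≡.trans (≡.cong (_*ᴺ q ^ k) (^-distribˡ-+-* q d k)) (*ᴺ-assoc (q ^ d) (q ^ k) (q ^ k))

      -- There are as many pairs as triples, so the injection euclid is onto.
      euclid-onto : TwoSetoids.OntoOn (Pairs (d +ᴺ k) k) Triples U U euclid
      euclid-onto = TwoSetoids.injective⇒onto (Pairs (d +ᴺ k) k) Triples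
        (×-decidable (Pw.decidable _≟_) (×-decidable (Pw.decidable _≟_) (Pw.decidable _≟_)))
        euclid (λ x y _ _ → euclid-injective x y) (λ _ _ → _)
        (≡.subst (HasCard _ U) same-size (everything (Vecs (d +ᴺ k)) (Vecs k) (vectors (d +ᴺ k)) (vectors k)))
        (everything (Vecs d) (Pairs k k) (vectors d) (everything (Vecs k) (Vecs k) (vectors k) (vectors k)))
        where
        everything : ∀ (S T : Setoid a (a ⊔ ℓ)) {N M} → HasCard (Setoid._≈_ S) U N → HasCard (Setoid._≈_ T) U M →
          HasCard (Setoid._≈_ (S ×ₛ T)) U (N *ᴺ M)
        everything S T all-S all-T = OneSetoid.card-⇔ (S ×ₛ T) (λ _ _ → _) (λ _ _ → _ , _) (TwoSetoids.card-× S T all-S all-T)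

    dividing : ∀ d k {N} → HasCard (Setoid._≈_ (Pairs k k)) CoprimeRemainder N →
      HasCard (Setoid._≈_ (Pairs (d +ᴺ k) k)) CoprimeMonics (q ^ d *ᴺ N)
    dividing d k remainders = TwoSetoids.card-preimage (Pairs (d +ᴺ k) k) Triples euclid euclid-cong
      (λ x y _ _ → euclid-injective x y)
      (λ (b , e) cop → _ , coprime-euclid⇒ (monic (quotient d b e)) (divide-spec d b e) cop) onto
      (TwoSetoids.card-× (Vecs d) (Pairs k k) (vectors d) remainders)
      where
      open Euclid d k
      onto : TwoSetoids.OntoOn (Pairs (d +ᴺ k) k) Triples CoprimeMonics (λ y → U (proj₁ y) × CoprimeRemainder (proj₂ y)) euclid
      onto y (_ , cop) with euclid-onto y _
      ... | (b , e) , _ , euclid≈y@(_ , e≈e′ , r≈r′) =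
        (b , e) ,
        coprime-euclid⇐ (monic (quotient d b e)) (divide-spec d b e)
          (coprime-resp (monic-cong (Pw.sym sym e≈e′)) (toList-cong (Pw.sym sym r≈r′)) cop) ,
        euclid≈y

    swapping : ∀ {j k N} → HasCard (Setoid._≈_ (Pairs k j)) CoprimeMonics N →
      HasCard (Setoid._≈_ (Pairs j k)) CoprimeMonics N
    swapping = TwoSetoids.card-image (Pairs _ _) (Pairs _ _) (λ (b , e) → e , b) (λ (b≈ , e≈) → e≈ , b≈)
      (λ _ _ _ _ (e≈ , b≈) → b≈ , e≈) (λ _ → coprime-sym) (λ (b , e) cop → (e , b) , coprime-sym cop , ≈ᵥ-refl , ≈ᵥ-refl)

    coprimeMonics : ∀ j k → HasCard (Setoid._≈_ (Pairs j k)) CoprimeMonics (coprimeCount j k)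
    coprimeMonics j k = <-rec (λ k → ∀ j → HasCard (Setoid._≈_ (Pairs j k)) CoprimeMonics (coprimeCount j k)) step k j
      where
      step : ∀ k → (∀ {n} → n < k → ∀ j → HasCard (Setoid._≈_ (Pairs j n)) CoprimeMonics (coprimeCount j n)) →
        ∀ j → HasCard (Setoid._≈_ (Pairs j k)) CoprimeMonics (coprimeCount j k)
      step k smaller j with k ≤? j
      ... | yes k≤j = ≡.subst (λ i → HasCard (Setoid._≈_ (Pairs i k)) CoprimeMonics (coprimeCount i k)) (m∸n+n≡m k≤j)
            (≡.subst (HasCard _ CoprimeMonics) (divisionCount (j ∸ k) k)
              (dividing (j ∸ k) k (remainders k k (λ m<k → smaller m<k k))))
      ... | no k≰j = ≡.subst (HasCard _ CoprimeMonics) (coprimeCount-sym k j) (swapping (smaller (≰⇒> k≰j) k))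

module Decomposing where

  open import Level using (Level; _⊔_)
  open import Algebra.Bundles using (CommutativeRing)
  open import Data.Nat using (ℕ; suc; _≤_; _<_; s≤s; _∸_; _^_) renaming (_+_ to _+ᴺ_)
  open import Data.Nat.Properties using (≤-trans; ≤-pred; m≤m+n; m∸n≤m; m+[n∸m]≡n; m+n∸m≡n)
  open import Data.Vec using (Vec)
  open import Data.Product using (Σ; _×_; _,_; proj₁; proj₂)
  open import Data.Product.Relation.Binary.Pointwise.NonDependent using (_×ₛ_)
  open import Relation.Binary.Bundles using (Setoid)
  open import Relation.Nullary using (¬_)
  import Relation.Binary.PropositionalEquality as ≡
  open ≡ using (_≡_)
  open import Defs using (HasCard; IsField; HasSize; Quad; _≈Q_; InS; toPoly)
  open FiniteCounting using (module OneSetoid; module TwoSetoids)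
  open Polynomials using (module PolyRing)
  open MonicPolynomials using (module Monic)
  open Coprimality using (module Coprime)
  open Counts using (module Arithmetic; degrees-split; degrees-join)
  open CoprimePairs using (module FiniteRing; module CoprimeCount)

  module Decomposition {a ℓ : Level} (F : CommutativeRing a ℓ) (isField : IsField F) (u : ℕ)
    (size : HasSize F (suc u)) (units : HasCard (CommutativeRing._≈_ F) (FiniteRing.NonZero F) u) where
    open PolyRing F
    open Monic F
    open Coprime F
    open Arithmetic u
    open CoprimeCount F isField u size units using (Vecs; vectors; coprimeMonics)

    private
      0≉1 : ¬ (0# ≈ 1#)
      0≉1 = proj₁ isField

    PolyPairs : Setoid a (a ⊔ ℓ)
    PolyPairs = ≋-setoid ×ₛ ≋-setoid

    _≈₂_ : Poly × Poly → Poly × Poly → Set (a ⊔ ℓ)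
    _≈₂_ = Setoid._≈_ PolyPairs

    monics : ∀ i → HasCard _≋_ (IsMonicDeg i) (q ^ i)
    monics i = TwoSetoids.card-image (Vecs i) ≋-setoid monic monic-cong (λ v w _ _ → monic-injective v w)
      (λ v _ → monic-IsMonicDeg v) (λ p (v , p≋v) → v , _ , ≋-sym p≋v) (vectors i)

    OfDegrees : ℕ → ℕ → Poly × Poly → Set (a ⊔ ℓ)
    OfDegrees i j (p , r) = IsMonicDeg i p × IsMonicDeg j r

    CoprimeOfDegrees : ℕ → ℕ → Poly × Poly → Set (a ⊔ ℓ)
    CoprimeOfDegrees j k x = OfDegrees j k x × Coprime (proj₁ x) (proj₂ x)

    coprimePolys : ∀ j k → HasCard _≈₂_ (CoprimeOfDegrees j k) (coprimeCount j k)
    coprimePolys j k = TwoSetoids.card-image (Vecs j ×ₛ Vecs k) PolyPairs (λ (b , e) → monic b , monic e)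
      (λ (b≈ , e≈) → monic-cong b≈ , monic-cong e≈) (λ (b , e) (b′ , e′) _ _ (b≋ , e≋) → monic-injective b b′ b≋ , monic-injective e e′ e≋)
      (λ (b , e) cop → (monic-IsMonicDeg b , monic-IsMonicDeg e) , cop)
      (λ (p , r) (((b , p≋b) , (e , r≋e)) , cop) → (b , e) , coprime-resp p≋b r≋e cop , ≋-sym p≋b , ≋-sym r≋e)
      (coprimeMonics j k)

    DegreeSum : (ℕ → ℕ → Poly × Poly → Set (a ⊔ ℓ)) → ℕ → Poly × Poly → Set (a ⊔ ℓ)
    DegreeSum Of t x = Σ ℕ λ i → i < suc t × Of i (t ∸ i) x

    -- Two equal pairs have equal first degrees, so the unions over i below are disjoint.
    private
      first-degree : ∀ {i i′ x y} → IsMonicDeg i (proj₁ x) → IsMonicDeg i′ (proj₁ y) → x ≈₂ y → i ≡ i′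
      first-degree deg deg′ (p≋p′ , _) = IsMonicDeg-unique 0≉1 deg deg′ p≋p′

    monicPairsCount : ∀ t → HasCard _≈₂_ (DegreeSum OfDegrees t) (monicPairs t)
    monicPairsCount t = OneSetoid.card-⋃ PolyPairs (λ i → OfDegrees i (t ∸ i)) _
      (λ i → TwoSetoids.card-× ≋-setoid ≋-setoid (monics i) (monics (t ∸ i)))
      (λ i i′ x y (deg , _) (deg′ , _) x≈y → first-degree deg deg′ x≈y) (suc t)

    coprimePairsCount : ∀ s → HasCard _≈₂_ (DegreeSum CoprimeOfDegrees s) (coprimePairs s)
    coprimePairsCount s = OneSetoid.card-⋃ PolyPairs (λ j → CoprimeOfDegrees j (s ∸ j)) _
      (λ j → coprimePolys j (s ∸ j))
      (λ j j′ x y ((deg , _) , _) ((deg′ , _) , _) x≈y → first-degree deg deg′ x≈y) (suc s)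

    ArrangedAt : ℕ → ℕ → (Poly × Poly) × (Poly × Poly) → Set (a ⊔ ℓ)
    ArrangedAt m s x = DegreeSum OfDegrees (m ∸ s) (proj₁ x) × DegreeSum CoprimeOfDegrees s (proj₂ x)

    Arrangement : ℕ → (Poly × Poly) × (Poly × Poly) → Set (a ⊔ ℓ)
    Arrangement m x = Σ ℕ λ s → s < suc m × ArrangedAt m s x

    arrangements : ∀ m → HasCard (Setoid._≈_ (PolyPairs ×ₛ PolyPairs)) (Arrangement m) (total m)
    arrangements m = OneSetoid.card-⋃ (PolyPairs ×ₛ PolyPairs) (ArrangedAt m) _
      (λ s → TwoSetoids.card-× PolyPairs PolyPairs (monicPairsCount (m ∸ s)) (coprimePairsCount s))
      same-s (suc m)
      where
      same-s : ∀ s s′ x y → ArrangedAt m s x → ArrangedAt m s′ y → Setoid._≈_ (PolyPairs ×ₛ PolyPairs) x y → s ≡ s′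
      same-s s s′ x y (_ , j , j<1+s , ((deg-b , deg-c) , _)) (_ , j′ , j′<1+s′ , ((deg-b′ , deg-c′) , _)) (_ , b≋b′ , c≋c′) =
        ≡.trans (≡.sym (m+[n∸m]≡n (≤-pred j<1+s)))
          (≡.trans (≡.cong₂ _+ᴺ_ (IsMonicDeg-unique 0≉1 deg-b deg-b′ b≋b′) (IsMonicDeg-unique 0≉1 deg-c deg-c′ c≋c′))
                   (m+[n∸m]≡n (≤-pred j′<1+s′)))

    Quads : ℕ → Setoid a (a ⊔ ℓ)
    Quads m = record
      { Carrier = Quad F m ; _≈_ = _≈Q_ F {m}
      ; isEquivalence = record
        { refl = ≋-refl , ≋-refl , ≋-refl , ≋-refl
        ; sym = λ (a≈ , b≈ , c≈ , d≈) → ≋-sym a≈ , ≋-sym b≈ , ≋-sym c≈ , ≋-sym d≈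
        ; trans = λ (a≈ , b≈ , c≈ , d≈) (a≈′ , b≈′ , c≈′ , d≈′) →
            ≋-trans a≈ a≈′ , ≋-trans b≈ b≈′ , ≋-trans c≈ c≈′ , ≋-trans d≈ d≈′ } }

    private
      product-degree : ∀ {i j k l} (va : Vec Carrier i) (vb : Vec Carrier j) (vc : Vec Carrier k) (vd : Vec Carrier l) →
        IsMonicDeg (i +ᴺ j +ᴺ k +ᴺ l) (monic va *ₚ monic vb *ₚ monic vc *ₚ monic vd)
      product-degree va vb vc vd =
        IsMonicDeg-*ₚ (IsMonicDeg-*ₚ (monic-*ₚ va vb) (monic-IsMonicDeg vc)) (monic-IsMonicDeg vd)

    𝓢-count : ∀ m → HasCard (_≈Q_ F {m}) (InS F m) (total m)
    𝓢-count m = TwoSetoids.card-preimage (Quads m) (PolyPairs ×ₛ PolyPairs) regroup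
      (λ (a≈ , b≈ , c≈ , d≈) → (a≈ , d≈) , b≈ , c≈)
      (λ _ _ _ _ ((a≈ , d≈) , b≈ , c≈) → a≈ , b≈ , c≈ , d≈)
      arranged onto (arrangements m)
      where
      regroup : Quad F m → (Poly × Poly) × (Poly × Poly)
      regroup (a , b , c , d) = (toPoly F a , toPoly F d) , (toPoly F b , toPoly F c)
      arranged : ∀ x → InS F m x → Arrangement m (regroup x)
      arranged ((ka , _ , va) , (kb , _ , vb) , (kc , _ , vc) , (kd , _ , vd)) (cop , deg)
        with degrees-split (IsMonicDeg-unique 0≉1 (product-degree va vb vc vd) deg ≋-refl)
      ... | s≤m , ka≤m∸s , m∸s∸ka≡kd =
        kb +ᴺ kc , s≤s s≤m ,
        (ka , s≤s ka≤m∸s , monic-IsMonicDeg va , ≡.subst (λ k → IsMonicDeg k (monic vd)) (≡.sym m∸s∸ka≡kd) (monic-IsMonicDeg vd)) ,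
        (kb , s≤s (m≤m+n kb kc) ,
          (monic-IsMonicDeg vb , ≡.subst (λ k → IsMonicDeg k (monic vc)) (≡.sym (m+n∸m≡n kb kc)) (monic-IsMonicDeg vc)) , cop)
      onto : ∀ y → Arrangement m y → Σ (Quad F m) λ x → InS F m x × Setoid._≈_ (PolyPairs ×ₛ PolyPairs) (regroup x) y
      onto ((p , r) , (b , e)) (s , s<1+m , (i , i<1+m∸s , (va , p≋a) , (vd , r≋d)) , (j , j<1+s , ((vb , b≋) , (vc , e≋)) , cop)) =
        ((i , ≤-trans i≤m∸s (m∸n≤m m s) , va) , (j , ≤-trans j≤s s≤m , vb) ,
         (s ∸ j , ≤-trans (m∸n≤m s j) s≤m , vc) , ((m ∸ s) ∸ i , ≤-trans (m∸n≤m (m ∸ s) i) (m∸n≤m m s) , vd)) ,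
        (coprime-resp b≋ e≋ cop ,
         ≡.subst (λ k → IsMonicDeg k (monic va *ₚ monic vb *ₚ monic vc *ₚ monic vd)) (degrees-join j≤s s≤m i≤m∸s) (product-degree va vb vc vd)) ,
        (≋-sym p≋a , ≋-sym r≋d) , ≋-sym b≋ , ≋-sym e≋
        where
        s≤m : s ≤ m
        s≤m = ≤-pred s<1+m
        j≤s : j ≤ s
        j≤s = ≤-pred j<1+s
        i≤m∸s : i ≤ m ∸ s
        i≤m∸s = ≤-pred i<1+m∸s

open import Defs
open import Level using (Level)
open import Algebra.Bundles using (CommutativeRing)
open import Data.Nat using (ℕ; zero; suc; _+_; _*_; _∸_; _^_; _≥_)
open import Data.Nat.Combinatorics using (_C_)
open import Data.Nat.Properties using (+-comm)
open import Data.Product using (_,_)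
import Relation.Binary.PropositionalEquality as ≡
open Counts using (module Arithmetic)
open CoprimePairs using (module FiniteRing)
open Decomposing using (module Decomposition)

lemma15 : ∀ {c ℓ : Level} (F : CommutativeRing c ℓ) → IsField F →
          (q : ℕ) → HasSize F q →
          (m : ℕ) → m ≥ 1 →
          HasCard (_≈Q_ F {m}) (InS F m)
            (q ^ (m ∸ 1) * (q ∸ 1) * ((m + 1) C 3) + q ^ m * ((m + 1) * (m + 1)))
lemma15 F isField q size zero ()
lemma15 F isField q size (suc m) _ with FiniteRing.nonzero-count F size
... | u , ≡.refl , units = ≡.subst (HasCard (_≈Q_ F) (InS F (suc m))) closed-form (𝓢-count (suc m))
  where
  open Decomposition F isField u size units using (𝓢-count)
  open Arithmetic u using (total; total-closed)
  closed-form : total (suc m) ≡.≡ suc u ^ m * u * ((suc m + 1) C 3) + suc u ^ suc m * ((suc m + 1) * (suc m + 1))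
  closed-form = ≡.trans (total-closed m)
    (≡.cong (λ n → suc u ^ m * u * (n C 3) + suc u ^ suc m * (n * n)) (+-comm 1 (suc m)))
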